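{- Let $f_A(x)=1-1/\sum_{n\ge0}n!\,x^n$ and $f_B(x)=\dfrac{\sum_{n\ge0}2^nn!\,x^n}{\sum_{n\ge0}n!\,x^n}$. Then $f_B(x)=\sum_{n\ge0}|\mathfrak B_n^{(0)}|x^n$, and for all $n,k\ge0$ the coefficient of $x^nt^k$ in $\dfrac{f_B(x)}{1-tf_A(x)}$ equals $|\mathfrak B_n^{(k)}|$.
   Context: $\mathfrak B_n$ is the group of signed permutations of $\{\pm1,\dots,\pm n\}$ ($w(-i)=-w(i)$), a Coxeter group with generators $\tau_0=(-1,1)$ and $\tau_i=(i,i+1)(-i,-i-1)$ for $1\le i\le n-1$; $\mathfrak B_0$ is trivial. $C(w)$ is the set of generators not occurring in any reduced expression of $w$, and $\mathfrak B_n^{(k)}=\{w\in\mathfrak B_n:|C(w)|=k\}$. -}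

module Defs where

open import Data.Nat as ℕ using (ℕ; zero; suc; _≤_; _∸_; _^_; _!)

open import Data.Integer as ℤ using (ℤ; +_; _*_; _+_; _-_; 0ℤ; 1ℤ; -_)
open import Data.Bool using (Bool; true; false; if_then_else_; _xor_)
open import Data.Fin as Fin using (Fin; zero; suc; inject₁; _≟_)
open import Data.Fin.Subset as Sub using (Subset; ∣_∣)
open import Data.Vec using (Vec; lookup; tabulate)
open import Data.List using (List; []; _∷_; length; map; upTo; foldr)
open import Data.List.Membership.Propositional as LM using ()
open import Data.List.Relation.Unary.Unique.Propositional using (Unique)
open import Data.Product using (Σ; _×_; _,_; proj₁; proj₂)
open import Relation.Nullary using (¬_; does)
open import Relation.Binary.PropositionalEquality using (_≡_)
open import Function.Bundles using (_⇔_)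

PS : Set
PS = ℕ → ℤ

-- bivariate series in x, t : coefficient of x^n t^k
PS2 : Set
PS2 = ℕ → ℕ → ℤ

sumℤ : List ℤ → ℤ
sumℤ = foldr _+_ 0ℤ

_⋆_ : PS → PS → PS
(a ⋆ b) n = sumℤ (map (λ i → a i * b (n ∸ i)) (upTo (suc n)))

_⋆₂_ : PS2 → PS2 → PS2
(a ⋆₂ b) n k =
  sumℤ (map (λ i → sumℤ (map (λ j → a i j * b (n ∸ i) (k ∸ j)) (upTo (suc k))))
            (upTo (suc n)))

oneS : PS
oneS zero = 1ℤ
oneS (suc _) = 0ℤ

factS : PS
factS n = + (n !)

twoFactS : PS
twoFactS n = + (2 ^ n ℕ.* n !)

oneMinusT : PS → PS2
oneMinusT f n zero = oneS n
oneMinusT f n (suc zero) = - f n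
oneMinusT f n (suc (suc _)) = 0ℤ

liftS : PS → PS2
liftS f n zero = f n
liftS f n (suc _) = 0ℤ

-- A (raw) signed map: entry i (0-based, standing for i+1) is (s , j),
-- meaning w(i+1) = -(j+1) if s = true and w(i+1) = j+1 if s = false;
-- w(-i) = -w(i) is then forced.
SP : ℕ → Set
SP n = Vec (Bool × Fin n) n

-- it is a signed permutation iff i ↦ |w(i)| is injective (hence bijective)
IsSignedPerm : ∀ {n} → SP n → Set
IsSignedPerm {n} w = ∀ (i j : Fin n) → proj₂ (lookup w i) ≡ proj₂ (lookup w j) → i ≡ j

act : ∀ {n} → SP n → Bool × Fin n → Bool × Fin n
act w (s , j) = (s xor proj₁ (lookup w j) , proj₂ (lookup w j))

_∘S_ : ∀ {n} → SP n → SP n → SP n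
u ∘S v = tabulate (λ i → act u (lookup v i))

idS : ∀ {n} → SP n
idS = tabulate (λ i → (false , i))

-- Coxeter generators, indexed by Fin n:
--   index 0 ↦ τ₀ = (-1,1) ;  index i ≥ 1 ↦ τᵢ = (i,i+1)(-i,-i-1)
gen : ∀ {n} → Fin n → SP n
gen {suc n} zero = tabulate (λ j → (does (j ≟ zero) , j))
gen {suc n} (suc m) = tabulate (λ j → (false , sw j))
  where
  sw : Fin (suc n) → Fin (suc n)
  sw j = if does (j ≟ suc m) then inject₁ m
         else (if does (j ≟ inject₁ m) then suc m else j)

eval : ∀ {n} → List (Fin n) → SP n
eval [] = idS
eval (g ∷ gs) = gen g ∘S eval gs

IsReduced : ∀ {n} → List (Fin n) → SP n → Set
IsReduced ws w = eval ws ≡ w × (∀ ws' → eval ws' ≡ w → length ws ≤ length ws')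

-- generator g occurs in no reduced expression of w, i.e. τ_g ∈ C(w)
InC : ∀ {n} → SP n → Fin n → Set
InC w g = ∀ ws → IsReduced ws w → ¬ (g LM.∈ ws)

CSize : ∀ {n} → SP n → ℕ → Set
CSize {n} w k = Σ (Subset n) λ S → (∀ g → (g Sub.∈ S) ⇔ InC w g) × ∣ S ∣ ≡ k

CardB : ℕ → ℕ → ℕ → Set
CardB n k c = Σ (List (SP n)) λ L →
  Unique L × length L ≡ c × (∀ w → (w LM.∈ L) ⇔ (IsSignedPerm w × CSize w k))

module Submission where

-- Write signed permutations in one-line notation and say that w has a cut at c (0 ≤ c < n) if w maps
-- the first c positions onto ±{1,…,c} and all later positions to positive values, i.e. w = u ⊕ v with v
-- unsigned; equivalently, w maps the tail {+(c+1), …, +n} onto itself. The type-B length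
-- ℓ = neg + inv + nsp satisfies ℓ(wτ) ≤ ℓ(w) + 1, ℓ(e) = 0, and every w ≠ e has a descent τ with
-- ℓ(wτ) < ℓ(w), so ℓ(w) is the length of a reduced word. Every generator other than τ_c preserves the
-- tail, so w has a cut at c when some reduced word avoids τ_c. Conversely, if w has a cut at c and a
-- reduced word A τ_c B (τ_c ∉ B) existed, then X = A τ_c = w B⁻¹ would preserve the tail, forcing
-- ℓ(X τ_c) > ℓ(X) and contradicting minimality. Hence |C(w)| is the number of cuts of w.
--
-- Splitting a signed permutation at its first cut gives 2ⁿn! = Σ_c |B_c^(0)| (n−c)!, i.e.
-- f_B · Σ n!xⁿ = Σ 2ⁿn!xⁿ. Splitting an unsigned permutation at its first cut c ≥ 1 gives
-- n! = Σ_c I_c (n−c)! for n ≥ 1, where I_c counts the unsigned permutations of size c without cuts in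
-- [1, c); so f_A = Σ I_c x^c. Splitting at the last cut gives |B_n^(k+1)| = Σ_c |B_c^(k)| I_(n−c), the
-- t-expansion of f_B / (1 − t f_A). Each of these convolution equations has a known factor with
-- constant coefficient 1, so it determines the unknown series uniquely.

module ListCounting where

  open import Data.Nat using (ℕ; zero; suc; _≤_; _<_; z≤n; s≤s; _+_; _*_)
  open import Data.Nat.Properties
  open import Data.Nat.ListAction using (sum)
  open import Data.Bool using (Bool; true; false)
  open import Data.List using (List; []; _∷_; length; _++_; map; concat; cartesianProduct)
  open import Data.List.Properties using (length-map; length-++; ∷-injectiveˡ; ∷-injectiveʳ)
  open import Data.List.Relation.Unary.All as All using (All; []; _∷_)
  import Data.List.Relation.Unary.All.Properties as AllP
  open import Data.List.Relation.Unary.AllPairs using ([]; _∷_)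
  open import Data.List.Relation.Unary.Any using (here; there)
  open import Data.List.Relation.Unary.Unique.Propositional using (Unique)
  import Data.List.Relation.Unary.Unique.Propositional.Properties as UP
  open import Data.List.Membership.Propositional using (_∈_)
  open import Data.List.Membership.Propositional.Properties using (∈-map⁻; ∈-++⁻; ∈-++⁺ˡ; ∈-++⁺ʳ; ∈-∃++; ∈-concat⁻′)
  open import Data.Product using (Σ; _×_; _,_; proj₁; proj₂)
  open import Data.Sum using (inj₁; inj₂)
  open import Data.Empty using (⊥-elim)
  open import Relation.Nullary using (¬_; does; yes; no; Dec)
  open import Relation.Binary.PropositionalEquality

  Iff : Set → Set → Set
  Iff A B = (A → B) × (B → A)

  length-cartesianProduct : ∀ {A B : Set} (xs : List A) (ys : List B) → length (cartesianProduct xs ys) ≡ length xs * length ys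
  length-cartesianProduct [] ys = refl
  length-cartesianProduct (x ∷ xs) ys = trans (length-++ (map (x ,_) ys)) (cong₂ _+_ (length-map (x ,_) ys) (length-cartesianProduct xs ys))

  ++-injective : ∀ {A : Set} (u u' w w' : List A) → length u ≡ length u' → u ++ w ≡ u' ++ w' → u ≡ u' × w ≡ w'
  ++-injective [] [] w w' _ e = refl , e
  ++-injective [] (x ∷ u') w w' () e
  ++-injective (x ∷ u) [] w w' () e
  ++-injective (x ∷ u) (y ∷ u') w w' l e with ++-injective u u' w w' (suc-injective l) (∷-injectiveʳ e)
  ... | (p , q) = cong₂ _∷_ (∷-injectiveˡ e) p , q

  Unique-length-mono : ∀ {A : Set} (xs ys : List A) → Unique xs → (∀ {z} → z ∈ xs → z ∈ ys) → length xs ≤ length ys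
  Unique-length-mono [] ys _ _ = z≤n
  Unique-length-mono (x ∷ xs) ys (x∉ ∷ uxs) sub with ∈-∃++ (sub (here refl))
  ... | (as , bs , refl) = ≤-trans (s≤s ih) (≤-reflexive (trans (sym (+-suc (length as) (length bs))) (sym (length-++ as))))
    where
    sub' : ∀ {z} → z ∈ xs → z ∈ as ++ bs
    sub' {z} zm with ∈-++⁻ as (sub (there zm))
    ... | inj₁ p = ∈-++⁺ˡ p
    ... | inj₂ (here refl) = ⊥-elim (All.lookup x∉ zm refl)
    ... | inj₂ (there p) = ∈-++⁺ʳ as p
    ih : length xs ≤ length as + length bs
    ih = ≤-trans (Unique-length-mono xs (as ++ bs) uxs sub') (≤-reflexive (length-++ as))

  Unique-length-≡ : ∀ {A : Set} (xs ys : List A) → Unique xs → Unique ys → (∀ z → Iff (z ∈ xs) (z ∈ ys)) → length xs ≡ length ys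
  Unique-length-≡ xs ys ux uy f = ≤-antisym (Unique-length-mono xs ys ux (λ {z} → proj₁ (f z))) (Unique-length-mono ys xs uy (λ {z} → proj₂ (f z)))

  Unique-map⁺-local : ∀ {A B : Set} (f : A → B) (xs : List A) → Unique xs →
    (∀ {x y} → x ∈ xs → y ∈ xs → f x ≡ f y → x ≡ y) → Unique (map f xs)
  Unique-map⁺-local f [] _ _ = []
  Unique-map⁺-local f (x ∷ xs) (x∉ ∷ ux) inj =
    AllP.map⁺ (All.tabulate (λ {y} ym e → All.lookup x∉ ym (inj (here refl) (there ym) e))) ∷
    Unique-map⁺-local f xs ux (λ xm ym e → inj (there xm) (there ym) e)

  Unique-concatMap : ∀ {A B : Set} (g : A → List B) (cs : List A) → Unique cs → (∀ c → Unique (g c)) →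
    (∀ c c' {t} → t ∈ g c → t ∈ g c' → c ≡ c') → Unique (concat (map g cs))
  Unique-concatMap g [] _ _ _ = []
  Unique-concatMap g (c ∷ cs) (c∉ ∷ ucs) ug tag = UP.++⁺ (ug c) (Unique-concatMap g cs ucs ug tag) disj
    where
    disj : ∀ {t} → ¬ (t ∈ g c × t ∈ concat (map g cs))
    disj (m1 , m2) with ∈-concat⁻′ (map g cs) m2
    ... | (xs , m3 , m4) with ∈-map⁻ g m4
    ...   | (c' , c'∈ , refl) = All.lookup c∉ c'∈ (tag c c' m1 m3)

  length-concat-map : ∀ {A B : Set} (g : A → List B) (cs : List A) → length (concat (map g cs)) ≡ sum (map (λ c → length (g c)) cs)
  length-concat-map g [] = refl
  length-concat-map g (c ∷ cs) = trans (length-++ (g c)) (cong (length (g c) +_) (length-concat-map g cs))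

  does-cong : ∀ {A B : Set} → Iff A B → (a : Dec A) (b : Dec B) → does a ≡ does b
  does-cong f (yes a) (yes b) = refl
  does-cong f (yes a) (no ¬b) = ⊥-elim (¬b (proj₁ f a))
  does-cong f (no ¬a) (yes b) = ⊥-elim (¬a (proj₂ f b))
  does-cong f (no ¬a) (no ¬b) = refl

  does≡true⇒ : ∀ {A : Set} (a : Dec A) → does a ≡ true → A
  does≡true⇒ (yes a) _ = a

  does≡false⇒ : ∀ {A : Set} (a : Dec A) → does a ≡ false → ¬ A
  does≡false⇒ (no ¬a) _ = ¬a

  boolToℕ : Bool → ℕ
  boolToℕ true = 1
  boolToℕ false = 0

  countBelow : (ℕ → Bool) → ℕ → ℕ
  countBelow f zero = 0
  countBelow f (suc n) = boolToℕ (f 0) + countBelow (λ x → f (suc x)) n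

  countBelow-+ : ∀ f a b → countBelow f (a + b) ≡ countBelow f a + countBelow (λ x → f (a + x)) b
  countBelow-+ f zero b = refl
  countBelow-+ f (suc a) b = trans (cong (boolToℕ (f 0) +_) (countBelow-+ (λ x → f (suc x)) a b)) (sym (+-assoc (boolToℕ (f 0)) _ _))

  countBelow-cong : ∀ f g n → (∀ x → x < n → f x ≡ g x) → countBelow f n ≡ countBelow g n
  countBelow-cong f g zero e = refl
  countBelow-cong f g (suc n) e = cong₂ _+_ (cong boolToℕ (e 0 (s≤s z≤n))) (countBelow-cong _ _ n (λ x x< → e (suc x) (s≤s x<)))

  countBelow≡0⇒ : ∀ f n → countBelow f n ≡ 0 → ∀ x → x < n → f x ≡ false
  countBelow≡0⇒ f (suc n) e zero _ with f 0
  ... | false = refl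
  ... | true = ⊥-elim (1+n≢0 e)
  countBelow≡0⇒ f (suc n) e (suc x) (s≤s x<) with f 0 in eq
  ... | false = countBelow≡0⇒ (λ x → f (suc x)) n e x x<
  ... | true = ⊥-elim (1+n≢0 e)

  countBelow≡0⇐ : ∀ f n → (∀ x → x < n → f x ≡ false) → countBelow f n ≡ 0
  countBelow≡0⇐ f zero h = refl
  countBelow≡0⇐ f (suc n) h rewrite h 0 (s≤s z≤n) = countBelow≡0⇐ (λ x → f (suc x)) n (λ x x< → h (suc x) (s≤s x<))

  countBelow≢0⇒ : ∀ f n → countBelow f n ≢ 0 → Σ ℕ λ x → x < n × f x ≡ true
  countBelow≢0⇒ f zero ne = ⊥-elim (ne refl)
  countBelow≢0⇒ f (suc n) ne with f 0 in eq
  ... | true = 0 , s≤s z≤n , eq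
  ... | false with countBelow≢0⇒ (λ x → f (suc x)) n ne
  ...   | (x , x< , p) = suc x , s≤s x< , p

  allBelow? : ∀ {P : ℕ → Set} → (∀ x → Dec (P x)) → ∀ n → Dec (∀ x → x < n → P x)
  allBelow? P? zero = yes (λ x ())
  allBelow? {P} P? (suc n) with allBelow? P? n | P? n
  ... | yes f | yes p = yes g
    where
    g : ∀ x → x < suc n → P x
    g x x< with m≤n⇒m<n∨m≡n (≤-pred x<)
    ... | inj₁ x<n = f x x<n
    ... | inj₂ refl = p
  ... | yes f | no ¬p = no (λ h → ¬p (h n ≤-refl))
  ... | no ¬f | _ = no (λ h → ¬f (λ x x< → h x (<-trans x< ≤-refl)))

  leastFrom : ∀ {P : ℕ → Set} → (∀ x → Dec (P x)) → ∀ lo k → P (lo + k) →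
    Σ ℕ λ j → lo ≤ j × j ≤ lo + k × P j × (∀ x → lo ≤ x → x < j → ¬ P x)
  leastFrom P? lo k p with P? lo
  ... | yes q = lo , ≤-refl , m≤m+n lo k , q , (λ x lo≤x x<lo → ⊥-elim (<⇒≱ x<lo lo≤x))
  leastFrom {P} P? lo zero p | no ¬q = ⊥-elim (¬q (subst P (+-identityʳ lo) p))
  leastFrom {P} P? lo (suc k) p | no ¬q with leastFrom P? (suc lo) k (subst P (+-suc lo k) p)
  ... | (j , slo≤j , j≤ , pj , none) = j , <⇒≤ slo≤j , ≤-trans j≤ (≤-reflexive (sym (+-suc lo k))) , pj , f
    where
    f : ∀ x → lo ≤ x → x < j → ¬ P x
    f x lo≤x x<j with m≤n⇒m<n∨m≡n lo≤x
    ... | inj₁ lo<x = none x lo<x x<j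
    ... | inj₂ refl = ¬q

  greatestBelow : ∀ {P : ℕ → Set} → (∀ x → Dec (P x)) → ∀ n x0 → x0 < n → P x0 →
    Σ ℕ λ c → c < n × P c × (∀ x → c < x → x < n → ¬ P x)
  greatestBelow {P} P? (suc n) x0 x0< p0 with P? n
  ... | yes q = n , ≤-refl , q , (λ x n<x x<sn → ⊥-elim (<⇒≱ n<x (≤-pred x<sn)))
  ... | no ¬q with greatestBelow P? n x0 (≤∧≢⇒< (≤-pred x0<) (λ e → ¬q (subst P e p0))) p0
  ...   | (c , c<n , pc , none) = c , <-trans c<n ≤-refl , pc , f
    where
    f : ∀ x → c < x → x < suc n → ¬ P x
    f x c<x x<sn with m≤n⇒m<n∨m≡n (≤-pred x<sn)
    ... | inj₁ x<n = none x c<x x<n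
    ... | inj₂ refl = ¬q


module Cuts where

  open ListCounting

  open import Data.Nat as ℕ using (ℕ; zero; suc; _≤_; _<_; z≤n; s≤s; _+_; _*_; _∸_; _^_; _!; _<?_; _≤?_; pred; _⊓_)
  open import Data.Nat.Properties as NP hiding (_≟_)
  open import Data.Nat.ListAction using (sum)
  open import Data.Nat.Tactic.RingSolver using (solve-∀)
  open import Data.Bool using (Bool; true; false)
  open import Data.Bool.Properties using () renaming (_≟_ to _≟B_)
  open import Data.List using (List; []; _∷_; length; _++_; map; concat; upTo; filter; take; drop; cartesianProduct)
  open import Data.List.Properties as LP using (length-map; length-++)
  open import Data.List.Relation.Unary.All as All using (All; []; _∷_)
  import Data.List.Relation.Unary.All.Properties as AllP
  open import Data.List.Relation.Unary.AllPairs using ([]; _∷_)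
  open import Data.List.Relation.Unary.Any using (here; there)
  open import Data.List.Relation.Unary.Unique.Propositional using (Unique)
  import Data.List.Relation.Unary.Unique.Propositional.Properties as UP
  open import Data.List.Membership.Propositional using (_∈_)
  open import Data.List.Membership.Propositional.Properties
    using (∈-map⁺; ∈-map⁻; ∈-concat⁻′; ∈-concat⁺′; ∈-cartesianProduct⁺; ∈-cartesianProduct⁻; ∈-upTo⁺; ∈-upTo⁻; ∈-filter⁺; ∈-filter⁻)
  open import Data.Product using (Σ; _×_; _,_; proj₁; proj₂)
  open import Data.Product.Properties using (,-injective; ,-injectiveʳ)
  open import Data.Empty using (⊥-elim)
  open import Data.Unit using (⊤; tt)
  open import Relation.Nullary using (¬_; does; yes; no; Dec)
  open import Relation.Nullary.Decidable using (_×-dec_; _→-dec_; ¬?; dec-true; dec-false)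
  open import Relation.Binary.Definitions using (tri<; tri≈; tri>)
  open import Relation.Binary.PropositionalEquality

  -- One-line notation, 0-based: (s , a) at position i stands for w(i+1) = ±(a+1), negative iff s.
  Signed : Set
  Signed = Bool × ℕ

  SList : Set
  SList = List Signed

  mapValue : (ℕ → ℕ) → SList → SList
  mapValue f = map (λ x → (proj₁ x , f (proj₂ x)))

  values : SList → List ℕ
  values = map proj₂

  IsSPerm : ℕ → SList → Set
  IsSPerm n r = length r ≡ n × All (λ x → proj₂ x < n) r × Unique (values r)

  values-mapValue : ∀ f r → values (mapValue f r) ≡ map f (values r)
  values-mapValue f [] = refl
  values-mapValue f (x ∷ r) = cong (f (proj₂ x) ∷_) (values-mapValue f r)

  punchIn : ℕ → ℕ → ℕ
  punchIn j a with a <? j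
  ... | yes _ = a
  ... | no _ = suc a

  punchOut : ℕ → ℕ → ℕ
  punchOut j a with a <? j
  ... | yes _ = a
  ... | no _ = pred a

  punchIn-< : ∀ {j a} → a < j → punchIn j a ≡ a
  punchIn-< {j} {a} p with a <? j
  ... | yes _ = refl
  ... | no ¬p = ⊥-elim (¬p p)

  punchIn-≮ : ∀ {j a} → ¬ a < j → punchIn j a ≡ suc a
  punchIn-≮ {j} {a} p with a <? j
  ... | yes q = ⊥-elim (p q)
  ... | no _ = refl

  punchOut-< : ∀ {j a} → a < j → punchOut j a ≡ a
  punchOut-< {j} {a} p with a <? j
  ... | yes _ = refl
  ... | no ¬p = ⊥-elim (¬p p)

  punchOut-≮ : ∀ {j a} → ¬ a < j → punchOut j a ≡ pred a
  punchOut-≮ {j} {a} p with a <? j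
  ... | yes q = ⊥-elim (p q)
  ... | no _ = refl

  punchOut-punchIn : ∀ j a → punchOut j (punchIn j a) ≡ a
  punchOut-punchIn j a with a <? j
  ... | yes p = punchOut-< p
  ... | no ¬p = punchOut-≮ {j} {suc a} (λ q → ¬p (<-trans (n<1+n a) q))

  punchIn-injective : ∀ j {a b} → punchIn j a ≡ punchIn j b → a ≡ b
  punchIn-injective j {a} {b} e = trans (sym (punchOut-punchIn j a)) (trans (cong (punchOut j) e) (punchOut-punchIn j b))

  punchIn-punchOut : ∀ j a → a ≢ j → punchIn j (punchOut j a) ≡ a
  punchIn-punchOut j a a≢j with a <? j
  ... | yes p = punchIn-< p
  punchIn-punchOut j zero a≢j | no ¬p = ⊥-elim (¬p (≤∧≢⇒< z≤n (λ e → a≢j (sym (sym e)))) )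
  punchIn-punchOut j (suc a) a≢j | no ¬p = punchIn-≮ {j} {a} (λ a<j → a≢j (≤-antisym a<j (≮⇒≥ ¬p)))

  punchIn≢ : ∀ j a → punchIn j a ≢ j
  punchIn≢ j a with a <? j
  ... | yes p = <⇒≢ p
  ... | no ¬p = λ e → ¬p (subst (a <_) e (n<1+n a))

  punchIn-bound : ∀ {n j a} → a < n → j ≤ n → punchIn j a < suc n
  punchIn-bound {n} {j} {a} a<n j≤n with a <? j
  ... | yes p = <-trans a<n (n<1+n n)
  ... | no ¬p = s≤s a<n

  punchOut-bound : ∀ {n j a} → a < suc n → a ≢ j → j < suc n → punchOut j a < n
  punchOut-bound {n} {j} {a} a<sn a≢j j<sn with a <? j
  ... | yes p = <-≤-trans p (≤-pred j<sn)
  punchOut-bound {n} {j} {zero} a<sn a≢j j<sn | no ¬p = ⊥-elim (¬p (≤∧≢⇒< z≤n (λ e → a≢j e)))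
  punchOut-bound {n} {j} {suc a} a<sn a≢j j<sn | no ¬p = ≤-pred a<sn

  consPunched : Bool × (ℕ × SList) → SList
  consPunched (b , j , p) = (b , j) ∷ mapValue (punchIn j) p

  signedPerms : List Bool → ℕ → List SList
  signedPerms signs zero = [] ∷ []
  signedPerms signs (suc n) = map consPunched (cartesianProduct signs (cartesianProduct (upTo (suc n)) (signedPerms signs n)))

  length-signedPerms : ∀ signs n → length (signedPerms signs n) ≡ length signs ^ n * n !
  length-signedPerms signs zero = refl
  length-signedPerms signs (suc n) = begin
      length (signedPerms signs (suc n))
    ≡⟨ length-map consPunched (cartesianProduct signs (cartesianProduct (upTo (suc n)) (signedPerms signs n))) ⟩
      length (cartesianProduct signs (cartesianProduct (upTo (suc n)) (signedPerms signs n)))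
    ≡⟨ length-cartesianProduct signs _ ⟩
      length signs * length (cartesianProduct (upTo (suc n)) (signedPerms signs n))
    ≡⟨ cong (length signs *_) (length-cartesianProduct (upTo (suc n)) (signedPerms signs n)) ⟩
      length signs * (length (upTo (suc n)) * length (signedPerms signs n))
    ≡⟨ cong₂ (λ a b → length signs * (a * b)) (LP.length-upTo (suc n)) (length-signedPerms signs n) ⟩
      length signs * (suc n * (length signs ^ n * n !))
    ≡⟨ rearrange (length signs) n (length signs ^ n) (n !) ⟩
      length signs ^ suc n * suc n ! ∎
    where
    open ≡-Reasoning
    rearrange : ∀ s n p f → s * (suc n * (p * f)) ≡ s * p * (f + n * f)
    rearrange = solve-∀

  consPunched-injective : ∀ {x y} → consPunched x ≡ consPunched y → x ≡ y
  consPunched-injective {b , j , p} {b' , j' , p'} e with ,-injective (LP.∷-injectiveˡ e)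
  ... | (refl , refl) = cong (λ q → b , j , q) (LP.map-injective finj (LP.∷-injectiveʳ e))
    where
    finj : ∀ {x y} → (proj₁ x , punchIn j (proj₂ x)) ≡ (proj₁ y , punchIn j (proj₂ y)) → x ≡ y
    finj {s , a} {t , c} e' with ,-injective e'
    ... | (refl , q) = cong (s ,_) (punchIn-injective j q)

  signedPerms-unique : ∀ signs n → Unique signs → Unique (signedPerms signs n)
  signedPerms-unique signs zero _ = [] ∷ []
  signedPerms-unique signs (suc n) uS = UP.map⁺ consPunched-injective (UP.cartesianProduct⁺ uS (UP.cartesianProduct⁺ (UP.upTo⁺ (suc n)) (signedPerms-unique signs n uS)))

  SignsIn : List Bool → SList → Set
  SignsIn signs r = All (λ x → proj₁ x ∈ signs) r

  ∈-signedPerms⁻ : ∀ signs n r → r ∈ signedPerms signs n → IsSPerm n r × SignsIn signs r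
  ∈-signedPerms⁻ signs zero .[] (here refl) = (refl , [] , []) , []
  ∈-signedPerms⁻ signs (suc n) r mem with ∈-map⁻ consPunched mem
  ... | ((b , j , p) , m2 , refl) with ∈-cartesianProduct⁻ signs _ m2
  ...   | (b∈ , m3) with ∈-cartesianProduct⁻ (upTo (suc n)) (signedPerms signs n) m3
  ...     | (j∈ , p∈) with ∈-signedPerms⁻ signs n p p∈
  ...       | ((lenp , bndp , unp) , sgp) = (cong suc (trans (length-map _ p) lenp) , j< ∷ bnd' , un') , (b∈ ∷ AllP.map⁺ (All.map (λ z → z) sgp))
    where
    j< : j < suc n
    j< = ∈-upTo⁻ j∈
    bnd' : All (λ x → proj₂ x < suc n) (mapValue (punchIn j) p)
    bnd' = AllP.map⁺ (All.map (λ a<n → punchIn-bound a<n (≤-pred j<)) bndp)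
    un' : Unique (j ∷ values (mapValue (punchIn j) p))
    un' rewrite values-mapValue (punchIn j) p = AllP.map⁺ (All.tabulate (λ {a} _ e → punchIn≢ j a (sym e))) ∷ UP.map⁺ (punchIn-injective j) unp

  ∈-signedPerms⁺ : ∀ signs n r → IsSPerm n r → SignsIn signs r → r ∈ signedPerms signs n
  ∈-signedPerms⁺ signs zero [] _ _ = here refl
  ∈-signedPerms⁺ signs zero (x ∷ r) (() , _) _
  ∈-signedPerms⁺ signs (suc n) [] (() , _) _
  ∈-signedPerms⁺ signs (suc n) ((b , j) ∷ t) (lenr , j< ∷ bndt , (j∉ ∷ unt)) (b∈ ∷ sgt) =
    subst (_∈ signedPerms signs (suc n)) (cong ((b , j) ∷_) t≡)
      (∈-map⁺ consPunched (∈-cartesianProduct⁺ b∈ (∈-cartesianProduct⁺ (∈-upTo⁺ j<) (∈-signedPerms⁺ signs n p vrp sgp))))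
    where
    p : SList
    p = mapValue (punchOut j) t
    ne : All (λ x → proj₂ x ≢ j) t
    ne = All.map (λ e e' → e (sym e')) (AllP.map⁻ j∉)
    t≡ : mapValue (punchIn j) p ≡ t
    t≡ = trans (sym (LP.map-∘ t)) (LP.map-id-local (All.map (λ {x} q → cong (proj₁ x ,_) (punchIn-punchOut j (proj₂ x) q)) ne))
    vrp : IsSPerm n p
    vrp = trans (length-map _ t) (NP.suc-injective lenr) ,
          AllP.map⁺ (All.zipWith (λ { (a<  , a≢) → punchOut-bound a< a≢ j< }) (bndt , ne)) ,
          UP.map⁻ (subst Unique (trans (cong values (sym t≡)) (values-mapValue (punchIn j) p)) unt)
    sgp : SignsIn signs p
    sgp = AllP.map⁺ sgt

  Unsigned : SList → Set
  Unsigned r = All (λ x → proj₁ x ≡ false) r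

  CutCompatible : ℕ → ℕ → Signed → Set
  CutCompatible c i x = (c ≤ i → proj₁ x ≡ false × c ≤ proj₂ x) × (i < c → proj₂ x < c)

  CutCompatible? : ∀ c i x → Dec (CutCompatible c i x)
  CutCompatible? c i x = (c ≤? i →-dec ((proj₁ x ≟B false) ×-dec (c ≤? proj₂ x))) ×-dec (i <? c →-dec (proj₂ x <? c))

  AllFrom : (ℕ → Signed → Set) → ℕ → SList → Set
  AllFrom P i [] = ⊤
  AllFrom P i (x ∷ xs) = P i x × AllFrom P (suc i) xs

  AllFrom? : ∀ {P : ℕ → Signed → Set} → (∀ i x → Dec (P i x)) → ∀ i xs → Dec (AllFrom P i xs)
  AllFrom? P? i [] = yes tt
  AllFrom? P? i (x ∷ xs) = P? i x ×-dec AllFrom? P? (suc i) xs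

  CutAt : ℕ → SList → Set
  CutAt c r = AllFrom (CutCompatible c) 0 r

  CutAt? : ∀ c r → Dec (CutAt c r)
  CutAt? c r = AllFrom? (CutCompatible? c) 0 r

  shift : ℕ → SList → SList
  shift c = mapValue (c +_)

  AllFrom-++⁻ : ∀ {P} i xs ys → AllFrom P i (xs ++ ys) → AllFrom P i xs × AllFrom P (i + length xs) ys
  AllFrom-++⁻ i [] ys p = tt , subst (λ z → AllFrom _ z ys) (sym (+-identityʳ i)) p
  AllFrom-++⁻ {P} i (x ∷ xs) ys (px , p) with AllFrom-++⁻ (suc i) xs ys p
  ... | (a , b) = (px , a) , subst (λ z → AllFrom P z ys) (sym (+-suc i (length xs))) b

  AllFrom-++⁺ : ∀ {P} i xs ys → AllFrom P i xs → AllFrom P (i + length xs) ys → AllFrom P i (xs ++ ys)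
  AllFrom-++⁺ i [] ys _ q = subst (λ z → AllFrom _ z ys) (+-identityʳ i) q
  AllFrom-++⁺ {P} i (x ∷ xs) ys (px , p) q = px , AllFrom-++⁺ (suc i) xs ys p (subst (λ z → AllFrom P z ys) (+-suc i (length xs)) q)

  AllFrom-intro : ∀ {P : ℕ → Signed → Set} {Q : Signed → Set} i xs → All Q xs →
    (∀ k x → i ≤ k → k < i + length xs → Q x → P k x) → AllFrom P i xs
  AllFrom-intro i [] [] f = tt
  AllFrom-intro i (x ∷ xs) (q ∷ qs) f =
    f i x ≤-refl (m<m+n i (s≤s z≤n)) q ,
    AllFrom-intro (suc i) xs qs (λ k y i<k k< qy → f k y (<⇒≤ i<k) (≤-trans k< (≤-reflexive (sym (+-suc i (length xs))))) qy)

  AllFrom-elim : ∀ {P : ℕ → Signed → Set} {Q : Signed → Set} i xs → AllFrom P i xs →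
    (∀ k x → i ≤ k → k < i + length xs → P k x → Q x) → All Q xs
  AllFrom-elim i [] _ f = []
  AllFrom-elim i (x ∷ xs) (px , p) f =
    f i x ≤-refl (m<m+n i (s≤s z≤n)) px ∷
    AllFrom-elim (suc i) xs p (λ k y i<k k< py → f k y (<⇒≤ i<k) (≤-trans k< (≤-reflexive (sym (+-suc i (length xs))))) py)

  CutCompatible-shift : ∀ c h i s a → Iff (CutCompatible (c + h) (c + i) (s , c + a)) (CutCompatible h i (s , a))
  CutCompatible-shift c h i s a =
    (λ { (p , q) → (λ h≤i → let r = p (+-monoʳ-≤ c h≤i) in proj₁ r , +-cancelˡ-≤ c h a (proj₂ r)) ,
                   (λ i<h → +-cancelˡ-< c a h (q (+-monoʳ-< c i<h))) }) ,
    (λ { (p , q) → (λ le → let r = p (+-cancelˡ-≤ c h i le) in proj₁ r , +-monoʳ-≤ c (proj₂ r)) ,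
                   (λ i<h → +-monoʳ-< c (q (+-cancelˡ-< c i h i<h))) })

  AllFrom-shift : ∀ c h i v → Iff (AllFrom (CutCompatible (c + h)) (c + i) (shift c v)) (AllFrom (CutCompatible h) i v)
  AllFrom-shift c h i [] = (λ _ → tt) , (λ _ → tt)
  AllFrom-shift c h i ((s , a) ∷ v) =
    (λ { (p , q) → proj₁ (CutCompatible-shift c h i s a) p ,
                   proj₁ (AllFrom-shift c h (suc i) v) (subst (λ z → AllFrom (CutCompatible (c + h)) z (shift c v)) (sym (+-suc c i)) q) }) ,
    (λ { (p , q) → proj₂ (CutCompatible-shift c h i s a) p ,
                   subst (λ z → AllFrom (CutCompatible (c + h)) z (shift c v)) (+-suc c i) (proj₂ (AllFrom-shift c h (suc i) v) q) })

  cutAt-length : ∀ c u → IsSPerm c u → CutAt c u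
  cutAt-length c u (len , bnd , _) = AllFrom-intro 0 u bnd (λ k x _ k< a< → (λ c≤k → ⊥-elim (<⇒≱ (subst (k <_) len k<) c≤k)) , (λ _ → a<))

  unsigned⇒cutAt0 : ∀ v → Unsigned v → CutAt 0 v
  unsigned⇒cutAt0 v uv = AllFrom-intro 0 v uv (λ k x _ _ sf → (λ _ → sf , z≤n) , (λ ()))

  cutAt-⊕ˡ : ∀ g c u v → g ≤ c → IsSPerm c u → Unsigned v → Iff (CutAt g (u ++ shift c v)) (CutAt g u)
  cutAt-⊕ˡ g c u v g≤c (len , _ , _) uv =
    (λ p → proj₁ (AllFrom-++⁻ 0 u (shift c v) p)) ,
    (λ p → AllFrom-++⁺ 0 u (shift c v) p
      (AllFrom-intro (length u) (shift c v) (AllP.map⁺ (All.map (λ sf → sf , m≤m+n c _) uv))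
        (λ k x u≤k _ q → (λ _ → proj₁ q , ≤-trans g≤c (proj₂ q)) ,
                         (λ k<g → ⊥-elim (<⇒≱ k<g (≤-trans g≤c (subst (_≤ k) len u≤k)))))))

  cutAt-⊕ʳ : ∀ c h u v → IsSPerm c u → Iff (CutAt (c + h) (u ++ shift c v)) (CutAt h v)
  cutAt-⊕ʳ c h u v (len , bnd , _) =
    (λ p → proj₁ (AllFrom-shift c h 0 v)
             (subst (λ z → AllFrom (CutCompatible (c + h)) z (shift c v)) (trans (cong (0 +_) len) (sym (+-identityʳ c)))
               (proj₂ (AllFrom-++⁻ 0 u (shift c v) p)))) ,
    (λ p → AllFrom-++⁺ 0 u (shift c v)
       (AllFrom-intro 0 u bnd (λ k x _ k< a< → (λ le → ⊥-elim (<⇒≱ (subst (k <_) len k<) (≤-trans (m≤m+n c h) le))) ,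
                                             (λ _ → ≤-trans a< (m≤m+n c h))))
       (subst (λ z → AllFrom (CutCompatible (c + h)) z (shift c v)) (trans (+-identityʳ c) (sym (cong (0 +_) len))) (proj₂ (AllFrom-shift c h 0 v) p)))

  values-shift : ∀ c v → values (shift c v) ≡ map (c +_) (values v)
  values-shift c v = values-mapValue (c +_) v

  IsSPerm-⊕ : ∀ c m u v → IsSPerm c u → IsSPerm m v → IsSPerm (c + m) (u ++ shift c v)
  IsSPerm-⊕ c m u v (lu , bu , uu) (lv , bv , uv) =
    trans (length-++ u) (cong₂ _+_ lu (trans (length-map _ v) lv)) ,
    AllP.++⁺ (All.map (λ a< → ≤-trans a< (m≤m+n c m)) bu) (AllP.map⁺ (All.map (λ a< → +-monoʳ-< c a<) bv)) ,
    subst Unique (sym (trans (LP.map-++ proj₂ u (shift c v)) (cong (values u ++_) (values-shift c v))))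
      (UP.++⁺ uu (UP.map⁺ (λ {x} {y} → +-cancelˡ-≡ c x y) uv) disj)
    where
    disj : ∀ {a} → ¬ (a ∈ values u × a ∈ map (c +_) (values v))
    disj (m1 , m2) with ∈-map⁻ (c +_) m2
    ... | (b , _ , refl) = <⇒≱ (All.lookup (AllP.map⁺ bu) m1) (m≤m+n c b)

  shift-injective : ∀ c {v v'} → shift c v ≡ shift c v' → v ≡ v'
  shift-injective c = LP.map-injective finj
    where
    finj : ∀ {x y} → (proj₁ x , c + proj₂ x) ≡ (proj₁ y , c + proj₂ y) → x ≡ y
    finj {s , a} {t , b} e with ,-injective e
    ... | (refl , q) = cong (s ,_) (+-cancelˡ-≡ c a b q)

  ⊕-injective : ∀ c u u' v v' → length u ≡ length u' → u ++ shift c v ≡ u' ++ shift c v' → u ≡ u' × v ≡ v'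
  ⊕-injective c u u' v v' l e with ++-injective u u' (shift c v) (shift c v') l e
  ... | (p , q) = p , shift-injective c q

  unshift : ℕ → SList → SList
  unshift c = mapValue (_∸ c)

  splitAtCut : ∀ n c r → IsSPerm n r → CutAt c r → c ≤ n →
    Σ SList λ u → Σ SList λ v → r ≡ u ++ shift c v × IsSPerm c u × IsSPerm (n ∸ c) v × Unsigned v
  splitAtCut n c r (lr , br , ur) cut c≤n = u , v , r≡ , (lu , bu , uu) , (lv , bv , uv) , unsv
    where
    u d v : SList
    u = take c r
    d = drop c r
    v = unshift c d
    lu : length u ≡ c
    lu = trans (LP.length-take c r) (m≤n⇒m⊓n≡m (subst (c ≤_) (sym lr) c≤n))
    parts : AllFrom (CutCompatible c) 0 u × AllFrom (CutCompatible c) (0 + length u) d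
    parts = AllFrom-++⁻ 0 u d (subst (CutAt c) (sym (LP.take++drop≡id c r)) cut)
    bu : All (λ x → proj₂ x < c) u
    bu = AllFrom-elim 0 u (proj₁ parts) (λ k x _ k< ok → proj₂ ok (subst (k <_) lu k<))
    dprop : All (λ x → proj₁ x ≡ false × c ≤ proj₂ x) d
    dprop = AllFrom-elim (0 + length u) d (proj₂ parts) (λ k x c≤k _ ok → proj₁ ok (subst (_≤ k) lu c≤k))
    shv : shift c v ≡ d
    shv = trans (sym (LP.map-∘ d)) (LP.map-id-local (All.map (λ {x} q → cong (proj₁ x ,_) (m+[n∸m]≡n (proj₂ q))) dprop))
    r≡ : r ≡ u ++ shift c v
    r≡ = trans (sym (LP.take++drop≡id c r)) (cong (u ++_) (sym shv))
    uu : Unique (values u)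
    uu = subst Unique (LP.take-map c r) (UP.take⁺ c ur)
    lv : length v ≡ n ∸ c
    lv = trans (length-map _ d) (trans (LP.length-drop c r) (cong (_∸ c) lr))
    bd : All (λ x → proj₂ x < n) d
    bd = AllP.drop⁺ c br
    bv : All (λ x → proj₂ x < n ∸ c) v
    bv = AllP.map⁺ (All.zipWith (λ { (a<n , (_ , c≤a)) → ∸-monoˡ-< a<n c≤a }) (bd , dprop))
    uv : Unique (values v)
    uv = UP.map⁻ (subst Unique (trans (cong values (sym shv)) (values-shift c v)) (subst Unique (LP.drop-map c r) (UP.drop⁺ c ur)))
    unsv : Unsigned v
    unsv = AllP.map⁺ (All.map proj₁ dprop)

  triples : (LA LB : ℕ → List SList) → ℕ → List (ℕ × (SList × SList))
  triples LA LB n = concat (map (λ c → map (c ,_) (cartesianProduct (LA c) (LB (n ∸ c)))) (upTo (suc n)))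

  join : ℕ × (SList × SList) → SList
  join (c , u , v) = u ++ shift c v

  joins : (LA LB : ℕ → List SList) → ℕ → List SList
  joins LA LB n = map join (triples LA LB n)

  length-joins : ∀ LA LB n → length (joins LA LB n) ≡ sum (map (λ c → length (LA c) * length (LB (n ∸ c))) (upTo (suc n)))
  length-joins LA LB n = trans (length-map join (triples LA LB n))
    (trans (length-concat-map (λ c → map (c ,_) (cartesianProduct (LA c) (LB (n ∸ c)))) (upTo (suc n)))
      (cong sum (LP.map-cong (λ c → trans (length-map (c ,_) (cartesianProduct (LA c) (LB (n ∸ c)))) (length-cartesianProduct (LA c) (LB (n ∸ c)))) (upTo (suc n)))))

  ∈-triples⁻ : ∀ LA LB n c u v → (c , u , v) ∈ triples LA LB n → c ≤ n × u ∈ LA c × v ∈ LB (n ∸ c)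
  ∈-triples⁻ LA LB n c u v m with ∈-concat⁻′ (map (λ c → map (c ,_) (cartesianProduct (LA c) (LB (n ∸ c)))) (upTo (suc n))) m
  ... | (xs , m1 , m2) with ∈-map⁻ (λ c → map (c ,_) (cartesianProduct (LA c) (LB (n ∸ c)))) m2
  ...   | (c' , c'∈ , refl) with ∈-map⁻ (c' ,_) m1
  ...     | ((u' , v') , m3 , refl) with ∈-cartesianProduct⁻ (LA c') (LB (n ∸ c')) m3
  ...       | (ua , vb) = ≤-pred (∈-upTo⁻ c'∈) , ua , vb

  ∈-triples⁺ : ∀ LA LB n c u v → c ≤ n → u ∈ LA c → v ∈ LB (n ∸ c) → (c , u , v) ∈ triples LA LB n
  ∈-triples⁺ LA LB n c u v c≤n ua vb =
    ∈-concat⁺′ (∈-map⁺ (c ,_) (∈-cartesianProduct⁺ ua vb)) (∈-map⁺ (λ c → map (c ,_) (cartesianProduct (LA c) (LB (n ∸ c)))) (∈-upTo⁺ (s≤s c≤n)))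

  triples-unique : ∀ LA LB n → (∀ c → Unique (LA c)) → (∀ m → Unique (LB m)) → Unique (triples LA LB n)
  triples-unique LA LB n uA uB = Unique-concatMap _ (upTo (suc n)) (UP.upTo⁺ (suc n))
    (λ c → UP.map⁺ ,-injectiveʳ (UP.cartesianProduct⁺ (uA c) (uB (n ∸ c))))
    tag
    where
    tag : ∀ c c' {t} → t ∈ map (c ,_) (cartesianProduct (LA c) (LB (n ∸ c))) → t ∈ map (c' ,_) (cartesianProduct (LA c') (LB (n ∸ c'))) → c ≡ c'
    tag c c' m1 m2 with ∈-map⁻ (c ,_) m1 | ∈-map⁻ (c' ,_) m2
    ... | (_ , _ , refl) | (_ , _ , e) = proj₁ (,-injective e)

  -- If each r of size n with Prop r has a unique selected cut c, where it splits as u ∈ LA c and an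
  -- unsigned v ∈ LB (n ∸ c), then joining all such pairs enumerates these r without repetition.
  module Decomposition
    (LA LB : ℕ → List SList) (PA PB : ℕ → SList → Set)
    (LA-ok : ∀ c u → Iff (u ∈ LA c) (IsSPerm c u × PA c u))
    (LB-ok : ∀ m v → Iff (v ∈ LB m) ((IsSPerm m v × Unsigned v) × PB m v))
    (uA : ∀ c → Unique (LA c)) (uB : ∀ m → Unique (LB m))
    (n : ℕ) (Sel : SList → ℕ → Set) (Prop : SList → Set)
    (sel-unique : ∀ r c c' → Sel r c → Sel r c' → c ≡ c')
    (char : ∀ c u v → c ≤ n → IsSPerm c u → IsSPerm (n ∸ c) v → Unsigned v →
       Iff (Sel (u ++ shift c v) c × Prop (u ++ shift c v)) (PA c u × PB (n ∸ c) v))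
    (exist : ∀ r → IsSPerm n r → Prop r → Σ ℕ λ c → c ≤ n × Sel r c × CutAt c r)
    where

    decomposed : List SList
    decomposed = joins LA LB n

    info : ∀ c u v → (c , u , v) ∈ triples LA LB n → c ≤ n × (IsSPerm c u × PA c u) × ((IsSPerm (n ∸ c) v × Unsigned v) × PB (n ∸ c) v)
    info c u v m with ∈-triples⁻ LA LB n c u v m
    ... | (c≤n , ua , vb) = c≤n , proj₁ (LA-ok c u) ua , proj₁ (LB-ok (n ∸ c) v) vb

    selected : ∀ c u v → (c , u , v) ∈ triples LA LB n → Sel (u ++ shift c v) c × Prop (u ++ shift c v)
    selected c u v m with info c u v m
    ... | (c≤n , (vu , pa) , ((vv , uv) , pb)) = proj₂ (char c u v c≤n vu vv uv) (pa , pb)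

    unique : Unique decomposed
    unique = Unique-map⁺-local join (triples LA LB n) (triples-unique LA LB n uA uB) inj
      where
      inj : ∀ {x y} → x ∈ triples LA LB n → y ∈ triples LA LB n → join x ≡ join y → x ≡ y
      inj {c , u , v} {c' , u' , v'} mx my e with sel-unique (join (c' , u' , v')) c c' (subst (λ z → Sel z c) e (proj₁ (selected c u v mx))) (proj₁ (selected c' u' v' my))
      ... | refl with ⊕-injective c u u' v v' (trans (proj₁ (proj₁ (proj₁ (proj₂ (info c u v mx))))) (sym (proj₁ (proj₁ (proj₁ (proj₂ (info c u' v' my))))))) e
      ...   | (refl , refl) = refl

    mem : ∀ r → Iff (r ∈ decomposed) (IsSPerm n r × Prop r)
    mem r = to , from
      where
      to : r ∈ decomposed → IsSPerm n r × Prop r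
      to m with ∈-map⁻ join m
      ... | ((c , u , v) , mt , refl) with info c u v mt
      ...   | (c≤n , (vu , _) , ((vv , _) , _)) =
        subst (λ z → IsSPerm z (u ++ shift c v)) (m+[n∸m]≡n c≤n) (IsSPerm-⊕ c (n ∸ c) u v vu vv) , proj₂ (selected c u v mt)
      from : IsSPerm n r × Prop r → r ∈ decomposed
      from (vr , pr) with exist r vr pr
      ... | (c , c≤n , sel , cut) with splitAtCut n c r vr cut c≤n
      ...   | (u , v , refl , vu , vv , uv) with proj₁ (char c u v c≤n vu vv uv) (sel , pr)
      ...     | (pa , pb) = ∈-map⁺ join (∈-triples⁺ LA LB n c u v c≤n (proj₂ (LA-ok c u) (vu , pa)) (proj₂ (LB-ok (n ∸ c) v) ((vv , uv) , pb)))

  numCuts : ℕ → SList → ℕ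
  numCuts n r = countBelow (λ c → does (CutAt? c r)) n

  numCuts-⊕ : ∀ c m u v → IsSPerm c u → Unsigned v → numCuts (c + m) (u ++ shift c v) ≡ numCuts c u + numCuts m v
  numCuts-⊕ c m u v vu uv = trans (countBelow-+ _ c m) (cong₂ _+_
    (countBelow-cong _ _ c (λ x x<c → does-cong (cutAt-⊕ˡ x c u v (<⇒≤ x<c) vu uv) (CutAt? x (u ++ shift c v)) (CutAt? x u)))
    (countBelow-cong _ _ m (λ x _ → does-cong (cutAt-⊕ʳ c x u v vu) (CutAt? (c + x) (u ++ shift c v)) (CutAt? x v))))

  numCuts≡0⇒ : ∀ n r → numCuts n r ≡ 0 → ∀ x → x < n → ¬ CutAt x r
  numCuts≡0⇒ n r e x x< = does≡false⇒ (CutAt? x r) (countBelow≡0⇒ _ n e x x<)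

  numCuts≡0⇐ : ∀ n r → (∀ x → x < n → ¬ CutAt x r) → numCuts n r ≡ 0
  numCuts≡0⇐ n r h = countBelow≡0⇐ _ n (λ x x< → dec-false (CutAt? x r) (h x x<))

  allSignedPerms : ℕ → List SList
  allSignedPerms = signedPerms (false ∷ true ∷ [])

  allPerms : ℕ → List SList
  allPerms = signedPerms (false ∷ [])

  signsIn-both : ∀ r → SignsIn (false ∷ true ∷ []) r
  signsIn-both [] = []
  signsIn-both ((false , a) ∷ r) = here refl ∷ signsIn-both r
  signsIn-both ((true , a) ∷ r) = there (here refl) ∷ signsIn-both r

  unsigned⇒signsIn : ∀ r → Unsigned r → SignsIn (false ∷ []) r
  unsigned⇒signsIn r u = All.map (λ e → here e) u

  signsIn⇒unsigned : ∀ r → SignsIn (false ∷ []) r → Unsigned r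
  signsIn⇒unsigned r s = All.map (λ { (here e) → e ; (there ()) }) s

  ∈-allSignedPerms : ∀ n r → Iff (r ∈ allSignedPerms n) (IsSPerm n r)
  ∈-allSignedPerms n r = (λ m → proj₁ (∈-signedPerms⁻ _ n r m)) , (λ v → ∈-signedPerms⁺ _ n r v (signsIn-both r))

  ∈-allPerms : ∀ n r → Iff (r ∈ allPerms n) (IsSPerm n r × Unsigned r)
  ∈-allPerms n r = (λ m → let p = ∈-signedPerms⁻ _ n r m in proj₁ p , signsIn⇒unsigned r (proj₂ p)) ,
              (λ { (v , u) → ∈-signedPerms⁺ _ n r v (unsigned⇒signsIn r u) })

  allSignedPerms-unique : ∀ n → Unique (allSignedPerms n)
  allSignedPerms-unique n = signedPerms-unique _ n (((λ ()) ∷ []) ∷ [] ∷ [])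

  allPerms-unique : ∀ n → Unique (allPerms n)
  allPerms-unique n = signedPerms-unique _ n ([] ∷ [])

  length-allSignedPerms : ∀ n → length (allSignedPerms n) ≡ 2 ^ n * n !
  length-allSignedPerms n = length-signedPerms _ n

  length-allPerms : ∀ n → length (allPerms n) ≡ n !
  length-allPerms n = trans (length-signedPerms _ n) (trans (cong (_* n !) (^-zeroˡ n)) (*-identityˡ (n !)))

  Indecomposable : ℕ → SList → Set
  Indecomposable m v = 1 ≤ m × (∀ x → x < m → 1 ≤ x → ¬ CutAt x v)

  Indecomposable? : ∀ m v → Dec (Indecomposable m v)
  Indecomposable? m v = (1 ≤? m) ×-dec allBelow? (λ x → (1 ≤? x) →-dec ¬? (CutAt? x v)) m

  indecomposables : ℕ → List SList
  indecomposables m = filter (Indecomposable? m) (allPerms m)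

  ∈-indecomposables : ∀ m v → Iff (v ∈ indecomposables m) ((IsSPerm m v × Unsigned v) × Indecomposable m v)
  ∈-indecomposables m v = (λ mem → let p = ∈-filter⁻ (Indecomposable? m) mem in proj₁ (∈-allPerms m v) (proj₁ p) , proj₂ p) ,
               (λ { (a , b) → ∈-filter⁺ (Indecomposable? m) (proj₂ (∈-allPerms m v) a) b })

  indecomposables-unique : ∀ m → Unique (indecomposables m)
  indecomposables-unique m = UP.filter⁺ (Indecomposable? m) (allPerms-unique m)

  numCuts-unsigned≡1 : ∀ m v → Unsigned v → 1 ≤ m → Iff (numCuts m v ≡ 1) (∀ x → x < m → 1 ≤ x → ¬ CutAt x v)
  numCuts-unsigned≡1 (suc m) v uv _ rewrite dec-true (CutAt? 0 v) (unsigned⇒cutAt0 v uv) =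
    (λ e x x< 1≤x → noProperCut (NP.suc-injective e) x x< 1≤x) , (λ f → cong suc (noProperCut⁻¹ f))
    where
    properCuts : ℕ
    properCuts = countBelow (λ x → does (CutAt? (suc x) v)) m
    noProperCut : properCuts ≡ 0 → ∀ x → x < suc m → 1 ≤ x → ¬ CutAt x v
    noProperCut e (suc x) (s≤s x<) _ = does≡false⇒ (CutAt? (suc x) v) (countBelow≡0⇒ _ m e x x<)
    noProperCut⁻¹ : (∀ x → x < suc m → 1 ≤ x → ¬ CutAt x v) → properCuts ≡ 0
    noProperCut⁻¹ f = countBelow≡0⇐ _ m (λ x x< → dec-false (CutAt? (suc x) v) (f (suc x) (s≤s x<) (s≤s z≤n)))

  -- Signed permutations of size n with exactly k cuts; for k + 1 cuts, split at the last one.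
  withCuts : ℕ → ℕ → List SList
  withCuts zero n = filter (λ r → numCuts n r ℕ.≟ 0) (allSignedPerms n)
  withCuts (suc k) n = joins (λ c → withCuts k c) indecomposables n

  IsLastCut : ℕ → SList → ℕ → Set
  IsLastCut n r c = c < n × CutAt c r × (∀ x → c < x → x < n → ¬ CutAt x r)

  isLastCut-unique : ∀ n r c c' → IsLastCut n r c → IsLastCut n r c' → c ≡ c'
  isLastCut-unique n r c c' (c< , cut , none) (c'< , cut' , none') with <-cmp c c'
  ... | tri< p _ _ = ⊥-elim (none c' p c'< cut')
  ... | tri≈ _ p _ = p
  ... | tri> _ _ p = ⊥-elim (none' c p c< cut)

  isLastCut-⊕ : ∀ k n c u v → c ≤ n → IsSPerm c u → IsSPerm (n ∸ c) v → Unsigned v →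
    Iff (IsLastCut n (u ++ shift c v) c × numCuts n (u ++ shift c v) ≡ suc k) (numCuts c u ≡ k × Indecomposable (n ∸ c) v)
  isLastCut-⊕ k n c u v c≤n vu vv uv = to , from
    where
    m : ℕ
    m = n ∸ c
    r : SList
    r = u ++ shift c v
    nm : c + m ≡ n
    nm = m+[n∸m]≡n c≤n
    eqn : numCuts n r ≡ numCuts c u + numCuts m v
    eqn = subst (λ z → numCuts z r ≡ numCuts c u + numCuts m v) nm (numCuts-⊕ c m u v vu uv)
    to : IsLastCut n r c × numCuts n r ≡ suc k → numCuts c u ≡ k × Indecomposable m v
    to ((c<n , cutc , none) , e) = eu , (1≤m , noneV)
      where
      1≤m : 1 ≤ m
      1≤m = m<n⇒0<n∸m c<n
      noneV : ∀ h → h < m → 1 ≤ h → ¬ CutAt h v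
      noneV h h<m 1≤h cv = none (c + h) (subst (_< c + h) (+-identityʳ c) (+-monoʳ-< c 1≤h))
        (subst (c + h <_) nm (+-monoʳ-< c h<m)) (proj₂ (cutAt-⊕ʳ c h u v vu) cv)
      v1 : numCuts m v ≡ 1
      v1 = proj₂ (numCuts-unsigned≡1 m v uv 1≤m) noneV
      eu : numCuts c u ≡ k
      eu = NP.suc-injective (trans (trans (+-comm 1 (numCuts c u)) (trans (cong (numCuts c u +_) (sym v1)) (sym eqn))) e)
    from : numCuts c u ≡ k × Indecomposable m v → IsLastCut n r c × numCuts n r ≡ suc k
    from (eu , (1≤m , noneV)) = (c<n , cutc , none) , trans eqn (trans (cong₂ _+_ eu v1) (+-comm k 1))
      where
      c<n : c < n
      c<n = subst (c <_) nm (subst (_< c + m) (+-identityʳ c) (+-monoʳ-< c 1≤m))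
      cutc : CutAt c r
      cutc = subst (λ z → CutAt z r) (+-identityʳ c) (proj₂ (cutAt-⊕ʳ c 0 u v vu) (unsigned⇒cutAt0 v uv))
      none : ∀ x → c < x → x < n → ¬ CutAt x r
      none x c<x x<n cx = noneV (x ∸ c) (∸-monoˡ-< x<n (<⇒≤ c<x)) (m<n⇒0<n∸m c<x)
        (proj₁ (cutAt-⊕ʳ c (x ∸ c) u v vu) (subst (λ z → CutAt z r) (sym (m+[n∸m]≡n (<⇒≤ c<x))) cx))
      v1 : numCuts m v ≡ 1
      v1 = proj₂ (numCuts-unsigned≡1 m v uv 1≤m) noneV

  lastCut-exists : ∀ k n r → IsSPerm n r → numCuts n r ≡ suc k → Σ ℕ λ c → c ≤ n × IsLastCut n r c × CutAt c r
  lastCut-exists k n r vr e with countBelow≢0⇒ (λ c → does (CutAt? c r)) n (λ e' → NP.1+n≢0 (trans (sym e) e'))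
  ... | (x0 , x0< , d) with greatestBelow (λ x → CutAt? x r) n x0 x0< (does≡true⇒ (CutAt? x0 r) d)
  ...   | (c , c<n , cut , none) = c , <⇒≤ c<n , (c<n , cut , none) , cut

  withCuts-spec : ∀ k → (∀ n r → Iff (r ∈ withCuts k n) (IsSPerm n r × numCuts n r ≡ k)) × (∀ n → Unique (withCuts k n))
  withCuts-spec zero = (λ n r → (λ m → let p = ∈-filter⁻ (λ r → numCuts n r ℕ.≟ 0) m in proj₁ (∈-allSignedPerms n r) (proj₁ p) , proj₂ p) ,
                         (λ { (vr , e) → ∈-filter⁺ (λ r → numCuts n r ℕ.≟ 0) (proj₂ (∈-allSignedPerms n r) vr) e })) ,
                (λ n → UP.filter⁺ (λ r → numCuts n r ℕ.≟ 0) (allSignedPerms-unique n))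
  withCuts-spec (suc k) = (λ n r → M.mem n r) , (λ n → M.unique n)
    where
    module M n = Decomposition
      (λ c → withCuts k c) indecomposables (λ c u → numCuts c u ≡ k) Indecomposable
      (proj₁ (withCuts-spec k)) ∈-indecomposables (proj₂ (withCuts-spec k)) indecomposables-unique
                   n (IsLastCut n) (λ r → numCuts n r ≡ suc k) (isLastCut-unique n) (isLastCut-⊕ k n) (lastCut-exists k n)

  ∈-withCuts : ∀ k n r → Iff (r ∈ withCuts k n) (IsSPerm n r × numCuts n r ≡ k)
  ∈-withCuts k = proj₁ (withCuts-spec k)

  withCuts-unique : ∀ k n → Unique (withCuts k n)
  withCuts-unique k = proj₂ (withCuts-spec k)

  indecCount : ℕ → ℕ
  indecCount m = length (indecomposables m)

  cutCount : ℕ → ℕ → ℕ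
  cutCount n k = length (withCuts k n)

  cutCount-suc : ∀ n k → cutCount n (suc k) ≡ sum (map (λ c → cutCount c k * indecCount (n ∸ c)) (upTo (suc n)))
  cutCount-suc n k = length-joins (λ c → withCuts k c) indecomposables n

  ∈-allPerms′ : ∀ m v → Iff (v ∈ allPerms m) ((IsSPerm m v × Unsigned v) × ⊤)
  ∈-allPerms′ m v = (λ p → proj₁ (∈-allPerms m v) p , tt) , (λ p → proj₂ (∈-allPerms m v) (proj₁ p))

  IsFirstCut : SList → ℕ → Set
  IsFirstCut r i = CutAt i r × (∀ x → x < i → ¬ CutAt x r)

  isFirstCut-unique : ∀ r c c' → IsFirstCut r c → IsFirstCut r c' → c ≡ c'
  isFirstCut-unique r c c' (cut , none) (cut' , none') with <-cmp c c'
  ... | tri< p _ _ = ⊥-elim (none' c p cut)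
  ... | tri≈ _ p _ = p
  ... | tri> _ _ p = ⊥-elim (none c' p cut')

  isFirstCut-⊕ : ∀ n c u v → c ≤ n → IsSPerm c u → IsSPerm (n ∸ c) v → Unsigned v →
    Iff (IsFirstCut (u ++ shift c v) c × ⊤) (numCuts c u ≡ 0 × ⊤)
  isFirstCut-⊕ n c u v c≤n vu vv uv =
    (λ { ((cutc , none) , _) → numCuts≡0⇐ c u (λ x x<c cu → none x x<c (proj₂ (cutAt-⊕ˡ x c u v (<⇒≤ x<c) vu uv) cu)) , tt }) ,
    (λ { (e , _) → (proj₂ (cutAt-⊕ˡ c c u v ≤-refl vu uv) (cutAt-length c u vu) ,
                    (λ x x<c cr → numCuts≡0⇒ c u e x x<c (proj₁ (cutAt-⊕ˡ x c u v (<⇒≤ x<c) vu uv) cr))) , tt })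

  firstCut-exists : ∀ n r → IsSPerm n r → ⊤ → Σ ℕ λ c → c ≤ n × IsFirstCut r c × CutAt c r
  firstCut-exists n r vr _ with leastFrom (λ x → CutAt? x r) 0 n (cutAt-length n r vr)
  ... | (j , _ , j≤n , cj , none) = j , j≤n , (cj , (λ x x<j → none x z≤n x<j)) , cj

  module ByFirstCut (n : ℕ) = Decomposition
    (λ c → withCuts 0 c) allPerms (λ c u → numCuts c u ≡ 0) (λ _ _ → ⊤)
    (∈-withCuts 0) ∈-allPerms′ (withCuts-unique 0) allPerms-unique
                        n IsFirstCut (λ _ → ⊤) isFirstCut-unique (isFirstCut-⊕ n) (firstCut-exists n)

  count-signedPerms-by-firstCut : ∀ n → 2 ^ n * n ! ≡ sum (map (λ c → cutCount c 0 * (n ∸ c) !) (upTo (suc n)))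
  count-signedPerms-by-firstCut n = trans (sym (length-allSignedPerms n)) (trans sameLength (trans (length-joins (λ c → withCuts 0 c) allPerms n)
           (cong sum (LP.map-cong (λ c → cong (cutCount c 0 *_) (length-allPerms (n ∸ c))) (upTo (suc n))))))
    where
    sameLength : length (allSignedPerms n) ≡ length (ByFirstCut.decomposed n)
    sameLength = Unique-length-≡ (allSignedPerms n) (ByFirstCut.decomposed n) (allSignedPerms-unique n) (ByFirstCut.unique n)
           (λ z → (λ m → proj₂ (ByFirstCut.mem n z) (proj₁ (∈-allSignedPerms n z) m , tt)) ,
                  (λ m → proj₂ (∈-allSignedPerms n z) (proj₁ (proj₁ (ByFirstCut.mem n z) m))))

  IsFirstProperCut : SList → ℕ → Set
  IsFirstProperCut r j = 1 ≤ j × CutAt j r × (∀ x → x < j → 1 ≤ x → ¬ CutAt x r)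

  isFirstProperCut-unique : ∀ r c c' → IsFirstProperCut r c → IsFirstProperCut r c' → c ≡ c'
  isFirstProperCut-unique r c c' (1≤c , cut , none) (1≤c' , cut' , none') with <-cmp c c'
  ... | tri< p _ _ = ⊥-elim (none' c p 1≤c cut)
  ... | tri≈ _ p _ = p
  ... | tri> _ _ p = ⊥-elim (none c' p 1≤c' cut')

  ∈-indecomposables′ : ∀ m v → Iff (v ∈ indecomposables m) (IsSPerm m v × (Unsigned v × Indecomposable m v))
  ∈-indecomposables′ m v = (λ p → let q = proj₁ (∈-indecomposables m v) p in proj₁ (proj₁ q) , proj₂ (proj₁ q) , proj₂ q) ,
                (λ { (a , b , c) → proj₂ (∈-indecomposables m v) ((a , b) , c) })

  isFirstProperCut-⊕ : ∀ n c u v → c ≤ n → IsSPerm c u → IsSPerm (n ∸ c) v → Unsigned v →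
    Iff (IsFirstProperCut (u ++ shift c v) c × Unsigned (u ++ shift c v)) ((Unsigned u × Indecomposable c u) × ⊤)
  isFirstProperCut-⊕ n c u v c≤n vu vv uv =
    (λ { ((1≤c , cutc , none) , ur) → (AllP.++⁻ˡ u ur , 1≤c , (λ x x<c 1≤x cu → none x x<c 1≤x (proj₂ (cutAt-⊕ˡ x c u v (<⇒≤ x<c) vu uv) cu))) , tt }) ,
    (λ { ((uu , 1≤c , noneu) , _) → (1≤c , proj₂ (cutAt-⊕ˡ c c u v ≤-refl vu uv) (cutAt-length c u vu) ,
            (λ x x<c 1≤x cr → noneu x x<c 1≤x (proj₁ (cutAt-⊕ˡ x c u v (<⇒≤ x<c) vu uv) cr))) ,
            AllP.++⁺ uu (AllP.map⁺ uv) })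

  firstProperCut-exists : ∀ n' r → IsSPerm (suc n') r → Unsigned r → Σ ℕ λ c → c ≤ suc n' × IsFirstProperCut r c × CutAt c r
  firstProperCut-exists n' r vr _ with leastFrom (λ x → CutAt? x r) 1 n' (cutAt-length (suc n') r vr)
  ... | (j , 1≤j , j≤ , cj , none) = j , j≤ , (1≤j , cj , (λ x x<j 1≤x → none x 1≤x x<j)) , cj

  module ByFirstProperCut (n' : ℕ) = Decomposition
    indecomposables allPerms (λ c u → Unsigned u × Indecomposable c u) (λ _ _ → ⊤)
    ∈-indecomposables′ ∈-allPerms′ indecomposables-unique allPerms-unique
                         (suc n') IsFirstProperCut Unsigned isFirstProperCut-unique (isFirstProperCut-⊕ (suc n')) (firstProperCut-exists n')

  count-perms-by-firstProperCut : ∀ n' → suc n' ! ≡ sum (map (λ j → indecCount j * (suc n' ∸ j) !) (upTo (suc (suc n'))))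
  count-perms-by-firstProperCut n' = trans (sym (length-allPerms (suc n'))) (trans sameLength (trans (length-joins indecomposables allPerms (suc n'))
           (cong sum (LP.map-cong (λ c → cong (indecCount c *_) (length-allPerms (suc n' ∸ c))) (upTo (suc (suc n')))))))
    where
    sameLength : length (allPerms (suc n')) ≡ length (ByFirstProperCut.decomposed n')
    sameLength = Unique-length-≡ (allPerms (suc n')) (ByFirstProperCut.decomposed n') (allPerms-unique (suc n')) (ByFirstProperCut.unique n')
           (λ z → (λ m → proj₂ (ByFirstProperCut.mem n' z) (proj₁ (∈-allPerms (suc n') z) m)) ,
                  (λ m → proj₂ (∈-allPerms (suc n') z) (proj₁ (ByFirstProperCut.mem n' z) m)))


module Coxeter where

  open import Defs
  open ListCounting
  open Cuts
  open import Data.Nat as ℕ using (ℕ; zero; suc; _≤_; _<_; z≤n; s≤s; _+_; _<?_; _≤?_)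
  open import Data.Nat.Properties as NP hiding (_≟_; suc-injective)
  open import Data.Nat.Tactic.RingSolver using (solve-∀)
  open import Algebra.Properties.CommutativeSemigroup +-commutativeSemigroup using (x∙yz≈y∙xz)
  open import Data.Bool using (Bool; true; false; if_then_else_; _xor_; not)
  open import Data.Bool.Properties using (xor-assoc; xor-same; xor-identityʳ)
  open import Data.Fin using (Fin; zero; suc; inject₁; _≟_; toℕ; fromℕ<)
  open import Data.Fin.Properties as FP using (toℕ-injective; toℕ-inject₁; suc-injective; toℕ<n; fromℕ<-toℕ; toℕ-fromℕ<)
  open import Data.Fin.Subset using (Subset; ∣_∣)
  open import Data.Maybe using (Maybe; just; nothing)
  open import Data.Maybe.Properties using (just-injective)
  open import Data.Vec as V using (Vec; []; _∷_; lookup; tabulate)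
  open import Data.Vec.Properties using (lookup∘tabulate; tabulate∘lookup; tabulate-cong; []=⇒lookup; lookup⇒[]=)
  open import Data.List as L using (List; []; _∷_; length; _++_; [_]; reverse; map)
  open import Data.List.Properties as LP using (length-++; unfold-reverse; length-map)
  open import Data.List.Relation.Unary.All as All using (All; []; _∷_)
  import Data.List.Relation.Unary.All.Properties as AllP
  open import Data.List.Relation.Unary.AllPairs using ([]; _∷_)
  open import Data.List.Relation.Unary.Any using (here; there; any?)
  open import Data.List.Relation.Unary.Unique.Propositional using (Unique)
  import Data.List.Relation.Unary.Unique.Propositional.Properties as UP
  open import Data.List.Membership.Propositional using (_∈_)
  open import Data.List.Membership.Propositional.Properties using (∈-map⁺; ∈-map⁻)
  open import Data.Product using (Σ; _×_; _,_; proj₁; proj₂)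
  open import Data.Sum using (_⊎_; inj₁; inj₂)
  open import Data.Empty using (⊥-elim)
  open import Data.Unit using (⊤; tt)
  open import Relation.Nullary using (¬_; does; yes; no)
  open import Relation.Nullary.Decidable using (dec-true; dec-false)
  open import Relation.Binary.Definitions using (tri<; tri≈; tri>)
  open import Relation.Binary.PropositionalEquality hiding ([_])
  open import Function.Bundles using (_⇔_; mk⇔; Equivalence)

  act-∘S : ∀ {n} (u v : SP n) x → act (u ∘S v) x ≡ act u (act v x)
  act-∘S u v (s , j) rewrite lookup∘tabulate (λ i → act u (lookup v i)) j with lookup v j
  ... | (t , a) = cong (_, proj₂ (lookup u a)) (sym (xor-assoc s t (proj₁ (lookup u a))))

  ∘S-assoc : ∀ {n} (u v w : SP n) → (u ∘S v) ∘S w ≡ u ∘S (v ∘S w)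
  ∘S-assoc u v w = tabulate-cong λ i → trans (act-∘S u v (lookup w i))
    (cong (act u) (sym (lookup∘tabulate (λ i → act v (lookup w i)) i)))

  lookup-idS : ∀ {n} (i : Fin n) → lookup (idS {n}) i ≡ (false , i)
  lookup-idS i = lookup∘tabulate (λ i → (false , i)) i

  act-idS : ∀ {n} (x : Bool × Fin n) → act idS x ≡ x
  act-idS (s , j) rewrite lookup-idS j | xor-identityʳ s = refl

  ∘S-idʳ : ∀ {n} (w : SP n) → w ∘S idS ≡ w
  ∘S-idʳ w = trans (tabulate-cong (λ i → cong (act w) (lookup-idS i))) (tabulate∘lookup w)

  ∘S-idˡ : ∀ {n} (w : SP n) → idS ∘S w ≡ w
  ∘S-idˡ w = trans (tabulate-cong (λ i → act-idS (lookup w i))) (tabulate∘lookup w)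

  -- The transposition used by Defs.gen, where it is local to a where block.
  adjSwap : ∀ {n} → Fin n → Fin (suc n) → Fin (suc n)
  adjSwap m j = if does (j ≟ suc m) then inject₁ m else (if does (j ≟ inject₁ m) then suc m else j)

  lookup-gen-zero : ∀ {n} (j : Fin (suc n)) → lookup (gen {suc n} zero) j ≡ (does (j ≟ zero) , j)
  lookup-gen-zero j = lookup∘tabulate (λ j → (does (j ≟ zero) , j)) j

  lookup-gen-suc : ∀ {n} (m : Fin n) (j : Fin (suc n)) → lookup (gen {suc n} (suc m)) j ≡ (false , adjSwap m j)
  lookup-gen-suc m j = lookup∘tabulate (λ j → (false , adjSwap m j)) j

  inject₁≢suc : ∀ {n} (m : Fin n) → inject₁ m ≢ suc m
  inject₁≢suc m e = NP.1+n≢n (sym (trans (sym (toℕ-inject₁ m)) (cong toℕ e)))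

  adjSwap-cases : ∀ {n} (m : Fin n) (j : Fin (suc n)) →
    (j ≡ suc m × adjSwap m j ≡ inject₁ m) ⊎ ((j ≡ inject₁ m × adjSwap m j ≡ suc m) ⊎ ((j ≢ suc m × j ≢ inject₁ m) × adjSwap m j ≡ j))
  adjSwap-cases m j with j ≟ suc m
  ... | yes p = inj₁ (p , refl)
  ... | no ¬p with j ≟ inject₁ m
  ...   | yes q = inj₂ (inj₁ (q , refl))
  ...   | no ¬q = inj₂ (inj₂ ((¬p , ¬q) , refl))

  adjSwap-involutive : ∀ {n} (m : Fin n) (j : Fin (suc n)) → adjSwap m (adjSwap m j) ≡ j
  adjSwap-involutive m j with adjSwap-cases m j
  ... | inj₁ (p , e) rewrite e | p | dec-false (inject₁ m ≟ suc m) (inject₁≢suc m) | dec-true (inject₁ m ≟ inject₁ m) refl = refl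
  ... | inj₂ (inj₁ (p , e)) rewrite e | p | dec-true (suc m ≟ suc m) refl = refl
  ... | inj₂ (inj₂ ((¬p , ¬q) , e)) rewrite e | dec-false (j ≟ suc m) ¬p | dec-false (j ≟ inject₁ m) ¬q = refl

  gen-involutive : ∀ {n} (g : Fin n) → gen g ∘S gen g ≡ idS
  gen-involutive {suc n} zero = tabulate-cong λ i → h i
    where
    h : ∀ i → act (gen zero) (lookup (gen zero) i) ≡ (false , i)
    h i rewrite lookup-gen-zero {n} i | lookup-gen-zero {n} i = cong (_, i) (xor-same (does (i ≟ zero)))
  gen-involutive {suc n} (suc m) = tabulate-cong λ i → h i
    where
    h : ∀ i → act (gen (suc m)) (lookup (gen (suc m)) i) ≡ (false , i)
    h i rewrite lookup-gen-suc m i | lookup-gen-suc m (adjSwap m i) = cong (false ,_) (adjSwap-involutive m i)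

  IsSignedPerm-∘S : ∀ {n} {u v : SP n} → IsSignedPerm u → IsSignedPerm v → IsSignedPerm (u ∘S v)
  IsSignedPerm-∘S {n} {u} {v} pu pv i j e =
    pv i j (pu _ _ (trans (sym (cong proj₂ (lookup∘tabulate (λ i → act u (lookup v i)) i)))
                     (trans e (cong proj₂ (lookup∘tabulate (λ i → act u (lookup v i)) j)))))

  IsSignedPerm-gen : ∀ {n} (g : Fin n) → IsSignedPerm (gen g)
  IsSignedPerm-gen g i j e = trans (sym (k i)) (trans (cong (λ z → proj₂ (lookup (gen g) z)) e) (k j))
    where
    k : ∀ i → proj₂ (lookup (gen g) (proj₂ (lookup (gen g) i))) ≡ i
    k i = trans (sym (cong proj₂ (lookup∘tabulate (λ i → act (gen g) (lookup (gen g) i)) i)))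
            (trans (cong (λ w → proj₂ (lookup w i)) (gen-involutive g)) (cong proj₂ (lookup-idS i)))

  ltBit : ℕ → ℕ → ℕ
  ltBit a b = if does (a <? b) then 1 else 0

  ltBit≤1 : ∀ a b → ltBit a b ≤ 1
  ltBit≤1 a b with a ℕ.<ᵇ b
  ... | true = ≤-refl
  ... | false = z≤n

  ltBit-< : ∀ {a b} → a < b → ltBit a b ≡ 1
  ltBit-< {a} {b} p with a ℕ.<ᵇ b | <⇒<ᵇ p
  ... | true | _ = refl

  ltBit-≮ : ∀ {a b} → ¬ a < b → ltBit a b ≡ 0
  ltBit-≮ {a} {b} p with a ℕ.<ᵇ b | <ᵇ⇒< a b
  ... | false | _ = refl
  ... | true | f = ⊥-elim (p (f tt))

  swapAt : ∀ {A : Set} {k} → Fin k → Vec A (suc k) → Vec A (suc k)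
  swapAt zero (x ∷ y ∷ xs) = y ∷ x ∷ xs
  swapAt (suc m) (x ∷ xs) = x ∷ swapAt m xs

  negateHead : ∀ {N k} → Vec (Bool × Fin N) (suc k) → Vec (Bool × Fin N) (suc k)
  negateHead ((s , a) ∷ xs) = (not s , a) ∷ xs

  module _ {N : ℕ} where
    SignedFin : Set
    SignedFin = Bool × Fin N

    -- For x before y this is [x > y] + [x + y < 0], so ℓ below is neg + inv + nsp.
    pairInversions : SignedFin → SignedFin → ℕ
    pairInversions (s , a) (false , b) = ltBit (toℕ b) (toℕ a)
    pairInversions (s , a) (true , b) = suc (ltBit (toℕ a) (toℕ b))

    negBit : SignedFin → ℕ
    negBit (true , _) = 1
    negBit (false , _) = 0

    inversionsWith : ∀ {m} → SignedFin → Vec SignedFin m → ℕ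
    inversionsWith x [] = 0
    inversionsWith x (y ∷ ys) = pairInversions x y + inversionsWith x ys

    ℓ : ∀ {m} → Vec SignedFin m → ℕ
    ℓ [] = 0
    ℓ (x ∷ xs) = negBit x + inversionsWith x xs + ℓ xs

    pairInversions-sign : ∀ s t a y → pairInversions (s , a) y ≡ pairInversions (t , a) y
    pairInversions-sign s t a (false , b) = refl
    pairInversions-sign s t a (true , b) = refl

    inversionsWith-sign : ∀ {m} s t a (ys : Vec SignedFin m) → inversionsWith (s , a) ys ≡ inversionsWith (t , a) ys
    inversionsWith-sign s t a [] = refl
    inversionsWith-sign s t a (y ∷ ys) = cong₂ _+_ (pairInversions-sign s t a y) (inversionsWith-sign s t a ys)

    pairInversions-flip-≤ : ∀ x y → pairInversions y x ≤ suc (pairInversions x y)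
    pairInversions-flip-≤ (false , a) (s , b) = ≤-trans (ltBit≤1 (toℕ a) (toℕ b)) (s≤s z≤n)
    pairInversions-flip-≤ (true , a) (false , b) = ≤-refl
    pairInversions-flip-≤ (true , a) (true , b) = s≤s (≤-trans (ltBit≤1 (toℕ b) (toℕ a)) (s≤s z≤n))

    inversionsWith-swapAt : ∀ {k} (x : SignedFin) (m : Fin k) (ys : Vec SignedFin (suc k)) → inversionsWith x (swapAt m ys) ≡ inversionsWith x ys
    inversionsWith-swapAt x zero (y ∷ z ∷ ys) = x∙yz≈y∙xz (pairInversions x z) (pairInversions x y) (inversionsWith x ys)
    inversionsWith-swapAt x (suc m) (y ∷ ys) = cong (pairInversions x y +_) (inversionsWith-swapAt x m ys)

    ℓ-swapAt : ∀ {k} (m : Fin k) (v : Vec (SignedFin) (suc k)) →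
      ℓ (swapAt m v) + pairInversions (lookup v (inject₁ m)) (lookup v (suc m)) ≡ ℓ v + pairInversions (lookup v (suc m)) (lookup v (inject₁ m))
    ℓ-swapAt zero (x ∷ y ∷ xs) =
      rearrange (negBit y) (pairInversions y x) (inversionsWith y xs) (negBit x) (inversionsWith x xs) (ℓ xs) (pairInversions x y)
      where
      rearrange : ∀ ny tyx sy nx sx l txy → ny + (tyx + sy) + (nx + sx + l) + txy ≡ nx + (txy + sx) + (ny + sy + l) + tyx
      rearrange = solve-∀
    ℓ-swapAt (suc m) (z ∷ xs) = begin
        negBit z + inversionsWith z (swapAt m xs) + ℓ (swapAt m xs) + t1
      ≡⟨ +-assoc (negBit z + inversionsWith z (swapAt m xs)) (ℓ (swapAt m xs)) t1 ⟩
        negBit z + inversionsWith z (swapAt m xs) + (ℓ (swapAt m xs) + t1)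
      ≡⟨ cong₂ (λ a b → negBit z + a + b) (inversionsWith-swapAt z m xs) (ℓ-swapAt m xs) ⟩
        negBit z + inversionsWith z xs + (ℓ xs + t2)
      ≡⟨ sym (+-assoc (negBit z + inversionsWith z xs) (ℓ xs) t2) ⟩
        negBit z + inversionsWith z xs + ℓ xs + t2 ∎
      where
      open ≡-Reasoning
      t1 t2 : ℕ
      t1 = pairInversions (lookup xs (inject₁ m)) (lookup xs (suc m))
      t2 = pairInversions (lookup xs (suc m)) (lookup xs (inject₁ m))

    ℓ-swapAt-≤ : ∀ {k} (m : Fin k) (v : Vec (SignedFin) (suc k)) → ℓ (swapAt m v) ≤ suc (ℓ v)
    ℓ-swapAt-≤ m v = +-cancelʳ-≤ t1 _ _ (begin
        ℓ (swapAt m v) + t1 ≡⟨ ℓ-swapAt m v ⟩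
        ℓ v + t2 ≤⟨ +-monoʳ-≤ (ℓ v) (pairInversions-flip-≤ (lookup v (inject₁ m)) (lookup v (suc m))) ⟩
        ℓ v + suc t1 ≡⟨ +-suc (ℓ v) t1 ⟩
        suc (ℓ v) + t1 ∎)
      where
      open ≤-Reasoning
      t1 t2 : ℕ
      t1 = pairInversions (lookup v (inject₁ m)) (lookup v (suc m))
      t2 = pairInversions (lookup v (suc m)) (lookup v (inject₁ m))

    ℓ-swapAt-< : ∀ {k} (m : Fin k) (v : Vec (SignedFin) (suc k)) →
      pairInversions (lookup v (suc m)) (lookup v (inject₁ m)) < pairInversions (lookup v (inject₁ m)) (lookup v (suc m)) →
      ℓ (swapAt m v) < ℓ v
    ℓ-swapAt-< m v lt' = +-cancelʳ-< t2 _ _ (begin-strict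
        ℓ (swapAt m v) + t2 <⟨ +-monoʳ-< (ℓ (swapAt m v)) lt' ⟩
        ℓ (swapAt m v) + t1 ≡⟨ ℓ-swapAt m v ⟩
        ℓ v + t2 ∎)
      where
      open ≤-Reasoning
      t1 t2 : ℕ
      t1 = pairInversions (lookup v (inject₁ m)) (lookup v (suc m))
      t2 = pairInversions (lookup v (suc m)) (lookup v (inject₁ m))

    ℓ-swapAt-> : ∀ {k} (m : Fin k) (v : Vec (SignedFin) (suc k)) →
      pairInversions (lookup v (inject₁ m)) (lookup v (suc m)) < pairInversions (lookup v (suc m)) (lookup v (inject₁ m)) →
      ℓ v < ℓ (swapAt m v)
    ℓ-swapAt-> m v lt' = +-cancelʳ-< t1 _ _ (begin-strict
        ℓ v + t1 <⟨ +-monoʳ-< (ℓ v) lt' ⟩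
        ℓ v + t2 ≡⟨ sym (ℓ-swapAt m v) ⟩
        ℓ (swapAt m v) + t1 ∎)
      where
      open ≤-Reasoning
      t1 t2 : ℕ
      t1 = pairInversions (lookup v (inject₁ m)) (lookup v (suc m))
      t2 = pairInversions (lookup v (suc m)) (lookup v (inject₁ m))

    ℓ-negateHead-false : ∀ {k} a (xs : Vec (SignedFin) k) → ℓ (negateHead ((false , a) ∷ xs)) ≡ suc (ℓ ((false , a) ∷ xs))
    ℓ-negateHead-false a xs = cong (λ z → suc (z + ℓ xs)) (inversionsWith-sign true false a xs)

    ℓ-negateHead-true : ∀ {k} a (xs : Vec (SignedFin) k) → suc (ℓ (negateHead ((true , a) ∷ xs))) ≡ ℓ ((true , a) ∷ xs)
    ℓ-negateHead-true a xs = cong (λ z → suc (z + ℓ xs)) (inversionsWith-sign false true a xs)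

    ℓ-negateHead-≤ : ∀ {k} (v : Vec (SignedFin) (suc k)) → ℓ (negateHead v) ≤ suc (ℓ v)
    ℓ-negateHead-≤ ((false , a) ∷ xs) = ≤-reflexive (ℓ-negateHead-false a xs)
    ℓ-negateHead-≤ ((true , a) ∷ xs) = ≤-trans (n≤1+n _) (≤-trans (≤-reflexive (ℓ-negateHead-true a xs)) (n≤1+n _))

  adjSwap-suc : ∀ {k} (m : Fin k) (i : Fin (suc k)) → adjSwap (suc m) (suc i) ≡ suc (adjSwap m i)
  adjSwap-suc m i with i ≟ suc m | i ≟ inject₁ m
  ... | yes _ | _ = refl
  ... | no _ | yes _ = refl
  ... | no _ | no _ = refl

  lookup-swapAt : ∀ {A : Set} {k} (m : Fin k) (v : Vec A (suc k)) i → lookup (swapAt m v) i ≡ lookup v (adjSwap m i)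
  lookup-swapAt zero (x ∷ y ∷ xs) zero = refl
  lookup-swapAt zero (x ∷ y ∷ xs) (suc zero) = refl
  lookup-swapAt zero (x ∷ y ∷ xs) (suc (suc i)) = refl
  lookup-swapAt (suc m) (x ∷ xs) zero = refl
  lookup-swapAt (suc m) (x ∷ xs) (suc i) rewrite adjSwap-suc m i = lookup-swapAt m xs i

  ∘S-gen-suc : ∀ {n} (w : SP (suc n)) (m : Fin n) → w ∘S gen (suc m) ≡ swapAt m w
  ∘S-gen-suc w m = trans (tabulate-cong h) (tabulate∘lookup (swapAt m w))
    where
    h : ∀ i → act w (lookup (gen (suc m)) i) ≡ lookup (swapAt m w) i
    h i rewrite lookup-gen-suc m i | lookup-swapAt m w i = refl

  ∘S-gen-zero : ∀ {n} (w : SP (suc n)) → w ∘S gen zero ≡ negateHead w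
  ∘S-gen-zero ((s , a) ∷ xs) = trans (tabulate-cong h) (tabulate∘lookup (negateHead ((s , a) ∷ xs)))
    where
    h : ∀ i → act ((s , a) ∷ xs) (lookup (gen zero) i) ≡ lookup (negateHead ((s , a) ∷ xs)) i
    h i rewrite lookup-gen-zero i with i
    ... | zero = refl
    ... | suc i' = refl

  ℓ-∘S-gen-≤ : ∀ {n} (w : SP n) (g : Fin n) → ℓ (w ∘S gen g) ≤ suc (ℓ w)
  ℓ-∘S-gen-≤ {suc n} w zero = subst (λ z → ℓ z ≤ suc (ℓ w)) (sym (∘S-gen-zero w)) (ℓ-negateHead-≤ w)
  ℓ-∘S-gen-≤ {suc n} w (suc m) = subst (λ z → ℓ z ≤ suc (ℓ w)) (sym (∘S-gen-suc w m)) (ℓ-swapAt-≤ m w)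

  InTail : ∀ {n} → Fin n → Bool × Fin n → Set
  InTail g (s , j) = s ≡ false × toℕ g ≤ toℕ j

  PreservesTail : ∀ {n} → Fin n → SP n → Set
  PreservesTail g w = ∀ x → Iff (InTail g (act w x)) (InTail g x)

  preservesTail-idS : ∀ {n} (g : Fin n) → PreservesTail g idS
  preservesTail-idS g x = subst (λ z → Iff (InTail g z) (InTail g x)) (sym (act-idS x)) ((λ p → p) , (λ p → p))

  preservesTail-∘S : ∀ {n} {g : Fin n} {u v : SP n} → PreservesTail g u → PreservesTail g v → PreservesTail g (u ∘S v)
  preservesTail-∘S {g = g} {u = u} {v} qu qv x = subst (λ z → Iff (InTail g z) (InTail g x)) (sym (act-∘S u v x))
    ((λ p → proj₁ (qv x) (proj₁ (qu (act v x)) p)) , (λ p → proj₂ (qu (act v x)) (proj₂ (qv x) p)))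

  adjSwap-≤-iff : ∀ {n} (g : Fin (suc n)) (m : Fin n) (j : Fin (suc n)) → g ≢ suc m →
    Iff (toℕ g ≤ toℕ (adjSwap m j)) (toℕ g ≤ toℕ j)
  adjSwap-≤-iff g m j g≢ with adjSwap-cases m j
  ... | inj₁ (p , e) rewrite e | p | toℕ-inject₁ m = (λ q → m≤n⇒m≤1+n q) , (λ q → ≤-pred (≤∧≢⇒< q (λ e' → g≢ (toℕ-injective e'))))
  ... | inj₂ (inj₁ (p , e)) rewrite e | p | toℕ-inject₁ m = (λ q → ≤-pred (≤∧≢⇒< q (λ e' → g≢ (toℕ-injective e')))) , (λ q → m≤n⇒m≤1+n q)
  ... | inj₂ (inj₂ (_ , e)) rewrite e = (λ q → q) , (λ q → q)

  preservesTail-gen : ∀ {n} {g h : Fin n} → h ≢ g → PreservesTail g (gen h)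
  preservesTail-gen {suc n} {zero} {zero} h≢g x = ⊥-elim (h≢g refl)
  preservesTail-gen {suc n} {suc m} {zero} h≢g (s , zero) rewrite lookup-gen-zero {n} zero =
    (λ p → ⊥-elim (NP.≤⇒≯ (proj₂ p) (s≤s z≤n))) , (λ p → ⊥-elim (NP.≤⇒≯ (proj₂ p) (s≤s z≤n)))
  preservesTail-gen {suc n} {suc m} {zero} h≢g (s , suc j) rewrite lookup-gen-zero {n} (suc j) | xor-identityʳ s = (λ p → p) , (λ p → p)
  preservesTail-gen {suc n} {g} {suc m} h≢g (s , j) rewrite lookup-gen-suc m j | xor-identityʳ s =
    (λ p → proj₁ p , proj₁ (adjSwap-≤-iff g m j (λ e → h≢g (sym e))) (proj₂ p)) ,
    (λ p → proj₁ p , proj₂ (adjSwap-≤-iff g m j (λ e → h≢g (sym e))) (proj₂ p))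

  pairInversions-desc : ∀ {N} c (x y : Bool × Fin N) → proj₁ y ≡ false → c ≤ toℕ (proj₂ y) →
    ¬ (proj₁ x ≡ false × c ≤ toℕ (proj₂ x)) → pairInversions x y < pairInversions y x
  pairInversions-desc c (true , a) (false , b) refl c≤b ¬p = ≤-refl
  pairInversions-desc c (false , a) (false , b) refl c≤b ¬p
    rewrite ltBit-≮ {toℕ b} {toℕ a} (λ b<a → ¬p (refl , ≤-trans c≤b (<⇒≤ b<a)))
          | ltBit-< {toℕ a} {toℕ b} (<-≤-trans (≰⇒> (λ c≤a → ¬p (refl , c≤a))) c≤b) = ≤-refl

  ℓ-<-∘S-gen : ∀ {n} {g : Fin n} {u : SP n} → PreservesTail g u → ℓ u < ℓ (u ∘S gen g)
  ℓ-<-∘S-gen {suc n} {zero} {(s , a) ∷ xs} q with proj₂ (q (false , zero)) (refl , z≤n)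
  ... | (refl , _) = subst (λ z → ℓ ((false , a) ∷ xs) < ℓ z) (sym (∘S-gen-zero ((false , a) ∷ xs)))
                      (≤-reflexive (sym (ℓ-negateHead-false a xs)))
  ℓ-<-∘S-gen {suc n} {suc m} {u} q = subst (λ z → ℓ u < ℓ z) (sym (∘S-gen-suc u m))
    (ℓ-swapAt-> m u (pairInversions-desc (suc (toℕ m)) (lookup u (inject₁ m)) (lookup u (suc m)) (proj₁ py) (proj₂ py) npx))
    where
    py : InTail (suc m) (lookup u (suc m))
    py = proj₂ (q (false , suc m)) (refl , ≤-refl)
    npx : ¬ InTail (suc m) (lookup u (inject₁ m))
    npx p = NP.1+n≰n (subst (suc (toℕ m) ≤_) (toℕ-inject₁ m) (proj₂ (proj₁ (q (false , inject₁ m)) p)))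

  module _ {N : ℕ} where
    NoAdjDescent : ∀ {k} → Vec (SignedFin {N}) (suc k) → Set
    NoAdjDescent (x ∷ []) = ⊤
    NoAdjDescent (x ∷ y ∷ xs) = pairInversions x y ≤ pairInversions y x × NoAdjDescent (y ∷ xs)

    adjDescent-or-none : ∀ {k} (v : Vec (SignedFin {N}) (suc k)) → (Σ (Fin k) λ m → ℓ (swapAt m v) < ℓ v) ⊎ NoAdjDescent v
    adjDescent-or-none (x ∷ []) = inj₂ tt
    adjDescent-or-none (x ∷ y ∷ xs) with pairInversions y x <? pairInversions x y
    ... | yes p = inj₁ (zero , ℓ-swapAt-< zero (x ∷ y ∷ xs) p)
    ... | no ¬p with adjDescent-or-none (y ∷ xs)
    ...   | inj₁ (m , q) = inj₁ (suc m , subst (λ z → negBit x + z + ℓ (swapAt m (y ∷ xs)) < negBit x + inversionsWith x (y ∷ xs) + ℓ (y ∷ xs))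
                                          (sym (inversionsWith-swapAt x m (y ∷ xs))) (+-monoʳ-< (negBit x + inversionsWith x (y ∷ xs)) q))
    ...   | inj₂ c = inj₂ (≮⇒≥ ¬p , c)

    IncreasingFrom : ∀ {m} → ℕ → Vec (SignedFin {N}) m → Set
    IncreasingFrom b [] = ⊤
    IncreasingFrom b ((s , a) ∷ xs) = s ≡ false × b ≤ toℕ a × IncreasingFrom (suc (toℕ a)) xs

    AbsInjective : ∀ {m} → Vec (SignedFin {N}) m → Set
    AbsInjective v = ∀ i j → proj₂ (lookup v i) ≡ proj₂ (lookup v j) → i ≡ j

    noAdjDescent-step : (x y : SignedFin {N}) → pairInversions x y ≤ pairInversions y x → proj₂ x ≢ proj₂ y → proj₁ x ≡ false →
      proj₁ y ≡ false × toℕ (proj₂ x) < toℕ (proj₂ y)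
    noAdjDescent-step (false , a) (true , b) le ne refl = ⊥-elim (NP.1+n≰n le)
    noAdjDescent-step (false , a) (false , b) le ne refl with <-cmp (toℕ a) (toℕ b)
    ... | tri< p _ _ = refl , p
    ... | tri≈ _ p _ = ⊥-elim (ne (toℕ-injective p))
    ... | tri> _ _ p rewrite ltBit-< p | ltBit-≮ (<⇒≯ p) = ⊥-elim (NP.1+n≰n le)

    noAdjDescent⇒increasing : ∀ {k} b (v : Vec (SignedFin {N}) (suc k)) → NoAdjDescent v → AbsInjective v →
      proj₁ (V.head v) ≡ false → b ≤ toℕ (proj₂ (V.head v)) → IncreasingFrom b v
    noAdjDescent⇒increasing b ((s , a) ∷ []) c inj sf b≤ = sf , b≤ , tt
    noAdjDescent⇒increasing b ((s , a) ∷ y ∷ xs) (c₁ , c) inj sf b≤ with noAdjDescent-step (s , a) y c₁ (λ e → FP.0≢1+n (inj zero (suc zero) e)) sf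
    ... | (yf , a<) = sf , b≤ , noAdjDescent⇒increasing (suc (toℕ a)) (y ∷ xs) c (λ i j e → suc-injective (inj (suc i) (suc j) e)) yf a<

    increasing-bound : ∀ {m} c (xs : Vec (SignedFin {N}) m) → IncreasingFrom c xs → c ≤ N → c + m ≤ N
    increasing-bound {zero} c [] _ c≤ = ≤-trans (≤-reflexive (+-identityʳ c)) c≤
    increasing-bound {suc m} c ((s , a) ∷ xs) (_ , c≤a , inc) _ =
      ≤-trans (≤-reflexive (+-suc c m)) (≤-trans (s≤s (+-monoˡ-≤ m c≤a)) (increasing-bound (suc (toℕ a)) xs inc (toℕ<n a)))

    increasing-values : ∀ {m} b (v : Vec (SignedFin {N}) m) → IncreasingFrom b v → b + m ≡ N →
      ∀ i → proj₁ (lookup v i) ≡ false × toℕ (proj₂ (lookup v i)) ≡ b + toℕ i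
    increasing-values b ((s , a) ∷ xs) (sf , b≤a , inc) e i = go i
      where
      m' : ℕ
      m' = V.length xs
      bnd : suc (toℕ a) + m' ≤ b + suc m'
      bnd = subst (suc (toℕ a) + m' ≤_) (sym e) (increasing-bound (suc (toℕ a)) xs inc (toℕ<n a))
      a≤b : toℕ a ≤ b
      a≤b = +-cancelʳ-≤ m' (toℕ a) b (≤-pred (≤-trans bnd (≤-reflexive (+-suc b m'))))
      a≡b : toℕ a ≡ b
      a≡b = ≤-antisym a≤b b≤a
      go : ∀ i → proj₁ (lookup ((s , a) ∷ xs) i) ≡ false × toℕ (proj₂ (lookup ((s , a) ∷ xs) i)) ≡ b + toℕ i
      go zero = sf , trans a≡b (sym (+-identityʳ b))
      go (suc i) with increasing-values (suc (toℕ a)) xs inc (trans (cong (λ z → suc z + m') a≡b) (trans (sym (+-suc b m')) e)) i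
      ... | (p , q) = p , trans q (trans (cong (λ z → suc z + toℕ i) a≡b) (sym (+-suc b (toℕ i))))

    inversionsWith-increasing : ∀ {m} c s a (xs : Vec (SignedFin {N}) m) → IncreasingFrom c xs → toℕ a < c → inversionsWith (s , a) xs ≡ 0
    inversionsWith-increasing c s a [] _ _ = refl
    inversionsWith-increasing c s a ((t , b) ∷ xs) (refl , c≤b , inc) a<c
      rewrite ltBit-≮ {toℕ b} {toℕ a} (λ b<a → <⇒≱ (<-≤-trans a<c c≤b) (<⇒≤ b<a)) =
      inversionsWith-increasing (suc (toℕ b)) s a xs inc (s≤s (≤-trans (<⇒≤ a<c) c≤b))

    ℓ-increasing : ∀ {m} b (v : Vec (SignedFin {N}) m) → IncreasingFrom b v → ℓ v ≡ 0
    ℓ-increasing b [] _ = refl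
    ℓ-increasing b ((s , a) ∷ xs) (refl , _ , inc) rewrite inversionsWith-increasing (suc (toℕ a)) false a xs inc ≤-refl = ℓ-increasing (suc (toℕ a)) xs inc

    increasing-tabulate : ∀ {m} b (f : Fin m → Fin N) → (∀ i → toℕ (f i) ≡ b + toℕ i) → IncreasingFrom b (tabulate (λ i → (false , f i)))
    increasing-tabulate {zero} b f e = tt
    increasing-tabulate {suc m} b f e = refl , ≤-trans (≤-reflexive (sym (+-identityʳ b))) (≤-reflexive (sym (e zero))) ,
      increasing-tabulate (suc (toℕ (f zero))) (λ i → f (suc i))
        (λ i → trans (e (suc i)) (trans (+-suc b (toℕ i)) (cong (λ z → suc z + toℕ i) (trans (sym (+-identityʳ b)) (sym (e zero))))))

  ℓ-idS : ∀ {n} → ℓ (idS {n}) ≡ 0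
  ℓ-idS {n} = ℓ-increasing {N = n} 0 idS (increasing-tabulate {N = n} 0 (λ i → i) (λ i → refl))

  increasing⇒idS : ∀ {n} (w : SP n) → IncreasingFrom 0 w → w ≡ idS
  increasing⇒idS {n} w inc = trans (sym (tabulate∘lookup w)) (tabulate-cong h)
    where
    h : ∀ i → lookup w i ≡ (false , i)
    h i with increasing-values 0 w inc refl i
    ... | (p , q) = cong₂ _,_ p (toℕ-injective q)

  descent-or-idS : ∀ {n} (w : SP n) → IsSignedPerm w → (Σ (Fin n) λ g → ℓ (w ∘S gen g) < ℓ w) ⊎ (w ≡ idS)
  descent-or-idS {zero} [] _ = inj₂ refl
  descent-or-idS {suc n} ((true , a) ∷ xs) _ = inj₁ (zero , subst (λ z → ℓ z < ℓ ((true , a) ∷ xs)) (sym (∘S-gen-zero ((true , a) ∷ xs)))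
                                                     (≤-reflexive (ℓ-negateHead-true a xs)))
  descent-or-idS {suc n} ((false , a) ∷ xs) pw with adjDescent-or-none ((false , a) ∷ xs)
  ... | inj₁ (m , p) = inj₁ (suc m , subst (λ z → ℓ z < ℓ ((false , a) ∷ xs)) (sym (∘S-gen-suc ((false , a) ∷ xs) m)) p)
  ... | inj₂ c = inj₂ (increasing⇒idS ((false , a) ∷ xs) (noAdjDescent⇒increasing 0 ((false , a) ∷ xs) c pw refl z≤n))

  eval-++ : ∀ {n} (xs ys : List (Fin n)) → eval (xs ++ ys) ≡ eval xs ∘S eval ys
  eval-++ [] ys = sym (∘S-idˡ (eval ys))
  eval-++ (h ∷ t) ys = trans (cong (gen h ∘S_) (eval-++ t ys)) (sym (∘S-assoc (gen h) (eval t) (eval ys)))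

  eval-reverse-inverse : ∀ {n} (xs : List (Fin n)) → eval xs ∘S eval (reverse xs) ≡ idS
  eval-reverse-inverse [] = ∘S-idˡ idS
  eval-reverse-inverse {n} (h ∷ t) = begin
      (g ∘S w) ∘S eval (reverse (h ∷ t))
    ≡⟨ cong (λ z → (g ∘S w) ∘S eval z) (unfold-reverse h t) ⟩
      (g ∘S w) ∘S eval (reverse t ++ [ h ])
    ≡⟨ cong ((g ∘S w) ∘S_) (eval-++ (reverse t) [ h ]) ⟩
      (g ∘S w) ∘S (w′ ∘S (g ∘S idS))
    ≡⟨ ∘S-assoc g w (w′ ∘S (g ∘S idS)) ⟩
      g ∘S (w ∘S (w′ ∘S (g ∘S idS)))
    ≡⟨ cong (g ∘S_) (sym (∘S-assoc w w′ (g ∘S idS))) ⟩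
      g ∘S ((w ∘S w′) ∘S (g ∘S idS))
    ≡⟨ cong (λ z → g ∘S (z ∘S (g ∘S idS))) (eval-reverse-inverse t) ⟩
      g ∘S (idS ∘S (g ∘S idS))
    ≡⟨ cong (g ∘S_) (trans (∘S-idˡ (g ∘S idS)) (∘S-idʳ g)) ⟩
      g ∘S g
    ≡⟨ gen-involutive h ⟩
      idS ∎
    where
    open ≡-Reasoning
    g w w′ : SP n
    g = gen h
    w = eval t
    w′ = eval (reverse t)

  ∘S-eval-reverse : ∀ {n} (u : SP n) (ws : List (Fin n)) → (u ∘S eval ws) ∘S eval (reverse ws) ≡ u
  ∘S-eval-reverse u ws = begin
      (u ∘S eval ws) ∘S eval (reverse ws) ≡⟨ ∘S-assoc u (eval ws) (eval (reverse ws)) ⟩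
      u ∘S (eval ws ∘S eval (reverse ws)) ≡⟨ cong (u ∘S_) (eval-reverse-inverse ws) ⟩
      u ∘S idS ≡⟨ ∘S-idʳ u ⟩
      u ∎
    where open ≡-Reasoning

  ∘S-gen-gen : ∀ {n} (u : SP n) (g : Fin n) → (u ∘S gen g) ∘S gen g ≡ u
  ∘S-gen-gen u g = begin
      (u ∘S gen g) ∘S gen g ≡⟨ ∘S-assoc u (gen g) (gen g) ⟩
      u ∘S (gen g ∘S gen g) ≡⟨ cong (u ∘S_) (gen-involutive g) ⟩
      u ∘S idS ≡⟨ ∘S-idʳ u ⟩
      u ∎
    where open ≡-Reasoning

  ℓ-∘S-eval : ∀ {n} (u : SP n) (ws : List (Fin n)) → ℓ (u ∘S eval ws) ≤ ℓ u + length ws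
  ℓ-∘S-eval u [] = ≤-trans (≤-reflexive (cong ℓ (∘S-idʳ u))) (m≤m+n _ 0)
  ℓ-∘S-eval u (h ∷ t) = begin
      ℓ (u ∘S (gen h ∘S eval t)) ≡⟨ cong ℓ (sym (∘S-assoc u (gen h) (eval t))) ⟩
      ℓ ((u ∘S gen h) ∘S eval t) ≤⟨ ℓ-∘S-eval (u ∘S gen h) t ⟩
      ℓ (u ∘S gen h) + length t ≤⟨ +-monoˡ-≤ (length t) (ℓ-∘S-gen-≤ u h) ⟩
      suc (ℓ u) + length t ≡⟨ sym (+-suc (ℓ u) (length t)) ⟩
      ℓ u + length (h ∷ t) ∎
    where open ≤-Reasoning

  ℓ-eval≤length : ∀ {n} (ws : List (Fin n)) → ℓ (eval ws) ≤ length ws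
  ℓ-eval≤length {n} ws = subst (λ z → ℓ z ≤ length ws) (∘S-idˡ (eval ws))
    (≤-trans (ℓ-∘S-eval idS ws) (≤-reflexive (cong (_+ length ws) (ℓ-idS {n}))))

  shortWord : ∀ {n} f (w : SP n) → ℓ w ≤ f → IsSignedPerm w →
    Σ (List (Fin n)) λ ws → eval ws ≡ w × length ws ≤ ℓ w
  shortWord f w b pw with descent-or-idS w pw
  ... | inj₂ e = [] , sym e , z≤n
  shortWord zero w b pw | inj₁ (g , p) = ⊥-elim (NP.<⇒≱ (<-≤-trans p b) z≤n)
  shortWord (suc f) w b pw | inj₁ (g , p) with shortWord f (w ∘S gen g) (≤-pred (<-≤-trans p b)) (IsSignedPerm-∘S {u = w} {v = gen g} pw (IsSignedPerm-gen g))
  ... | (ws' , e' , l') = ws' L.∷ʳ g , ev , len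
    where
    open ≡-Reasoning
    ev : eval (ws' ++ [ g ]) ≡ w
    ev = begin
        eval (ws' ++ [ g ]) ≡⟨ eval-++ ws' [ g ] ⟩
        eval ws' ∘S (gen g ∘S idS) ≡⟨ cong₂ _∘S_ e' (∘S-idʳ (gen g)) ⟩
        (w ∘S gen g) ∘S gen g ≡⟨ ∘S-gen-gen w g ⟩
        w ∎
    len : length (ws' ++ [ g ]) ≤ ℓ w
    len = ≤-trans (≤-reflexive (trans (length-++ ws') (+-comm (length ws') 1))) (≤-trans (s≤s l') p)

  preservesTail-eval : ∀ {n} {g : Fin n} (ws : List (Fin n)) → All (λ h → h ≢ g) ws → PreservesTail g (eval ws)
  preservesTail-eval [] [] = preservesTail-idS _
  preservesTail-eval {g = g} (h ∷ t) (p ∷ ps) = preservesTail-∘S {g = g} {u = gen h} {v = eval t} (preservesTail-gen {g = g} {h = h} p) (preservesTail-eval t ps)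

  All-reverse : ∀ {A : Set} {P : A → Set} (xs : List A) → All P xs → All P (reverse xs)
  All-reverse [] [] = []
  All-reverse (x ∷ xs) (p ∷ ps) = subst (All _) (sym (unfold-reverse x xs)) (AllP.++⁺ (All-reverse xs ps) (p ∷ []))

  ∉⇒All≢ : ∀ {n} {g : Fin n} (ws : List (Fin n)) → ¬ (g ∈ ws) → All (λ h → h ≢ g) ws
  ∉⇒All≢ [] _ = []
  ∉⇒All≢ (h ∷ t) ¬p = (λ e → ¬p (here (sym e))) ∷ ∉⇒All≢ t (λ q → ¬p (there q))

  lastOccurrence : ∀ {n} (g : Fin n) (ws : List (Fin n)) → g ∈ ws →
    Σ (List (Fin n)) λ A → Σ (List (Fin n)) λ B → ws ≡ A ++ g ∷ B × All (λ h → h ≢ g) B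
  lastOccurrence g (h ∷ t) p with any? (g ≟_) t
  ... | yes q with lastOccurrence g t q
  ...   | (A , B , e , al) = h ∷ A , B , cong (h ∷_) e , al
  lastOccurrence g (h ∷ t) (here e) | no ¬q = [] , t , cong (_∷ t) (sym e) , ∉⇒All≢ t ¬q
  lastOccurrence g (h ∷ t) (there q) | no ¬q = ⊥-elim (¬q q)

  reducedWord : ∀ {n} (w : SP n) → IsSignedPerm w → Σ (List (Fin n)) λ ws → IsReduced ws w × length ws ≤ ℓ w
  reducedWord w pw with shortWord (ℓ w) w ≤-refl pw
  ... | (ws , e , l) = ws , (e , (λ ws' e' → ≤-trans l (≤-trans (≤-reflexive (cong ℓ (sym e'))) (ℓ-eval≤length ws')))) , l

  InC⇒preservesTail : ∀ {n} (w : SP n) (g : Fin n) → IsSignedPerm w → InC w g → PreservesTail g w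
  InC⇒preservesTail w g pw ic with reducedWord w pw
  ... | (ws , red , _) = subst (PreservesTail g) (proj₁ red) (preservesTail-eval ws (∉⇒All≢ ws (ic ws red)))

  -- A reduced word A g B with g ∉ B factors w = X · eval B with X = eval A · τ_g preserving the
  -- tail, so ℓ X < |A|; but reducedness forces |A| + 1 + |B| ≤ ℓ w ≤ ℓ X + |B|.
  preservesTail⇒InC : ∀ {n} (w : SP n) (g : Fin n) → IsSignedPerm w → PreservesTail g w → InC w g
  preservesTail⇒InC {n} w g pw q ws (e , minimal) g∈ws with reducedWord w pw | lastOccurrence g ws g∈ws
  ... | (ws₀ , red₀ , len₀) | (A , B , ws≡ , g∉B) = ⊥-elim (NP.<⇒≱ ℓX<A (<⇒≤ A<ℓX))
    where
    X : SP n
    X = eval A ∘S gen g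
    w≡X∘B : w ≡ X ∘S eval B
    w≡X∘B = begin
        w ≡⟨ sym e ⟩
        eval ws ≡⟨ cong eval ws≡ ⟩
        eval (A ++ g ∷ B) ≡⟨ eval-++ A (g ∷ B) ⟩
        eval A ∘S (gen g ∘S eval B) ≡⟨ sym (∘S-assoc (eval A) (gen g) (eval B)) ⟩
        X ∘S eval B ∎
      where open ≡-Reasoning
    preservesX : PreservesTail g X
    preservesX = subst (PreservesTail g) (trans (cong (_∘S eval (reverse B)) w≡X∘B) (∘S-eval-reverse X B))
      (preservesTail-∘S {g = g} {u = w} {v = eval (reverse B)} q (preservesTail-eval (reverse B) (All-reverse B g∉B)))
    ℓX<A : ℓ X < length A
    ℓX<A = <-≤-trans (ℓ-<-∘S-gen {g = g} {u = X} preservesX)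
      (≤-trans (≤-reflexive (cong ℓ (∘S-gen-gen (eval A) g))) (ℓ-eval≤length A))
    A<ℓX : suc (length A) ≤ ℓ X
    A<ℓX = +-cancelʳ-≤ (length B) _ _ (begin
        suc (length A) + length B ≡⟨ sym (+-suc (length A) (length B)) ⟩
        length A + length (g ∷ B) ≡⟨ sym (length-++ A) ⟩
        length (A ++ g ∷ B) ≡⟨ cong length (sym ws≡) ⟩
        length ws ≤⟨ ≤-trans (minimal ws₀ (proj₁ red₀)) len₀ ⟩
        ℓ w ≡⟨ cong ℓ w≡X∘B ⟩
        ℓ (X ∘S eval B) ≤⟨ ℓ-∘S-eval X B ⟩
        ℓ X + length B ∎)
      where open ≤-Reasoning

  entry : ∀ {n} → SP n → Fin n → Signed
  entry w i = (proj₁ (lookup w i) , toℕ (proj₂ (lookup w i)))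

  toSList : ∀ {n} → SP n → SList
  toSList w = L.tabulate (entry w)

  Unique-tabulate⁻ : ∀ {n} (h : Fin n → ℕ) → Unique (L.tabulate h) → ∀ i j → h i ≡ h j → i ≡ j
  Unique-tabulate⁻ h _ zero zero _ = refl
  Unique-tabulate⁻ h (a ∷ _) zero (suc j) e = ⊥-elim (AllP.tabulate⁻ a j e)
  Unique-tabulate⁻ h (a ∷ _) (suc i) zero e = ⊥-elim (AllP.tabulate⁻ a i (sym e))
  Unique-tabulate⁻ h (_ ∷ u) (suc i) (suc j) e = cong suc (Unique-tabulate⁻ (λ x → h (suc x)) u i j e)

  values-toSList : ∀ {n} (w : SP n) → values (toSList w) ≡ L.tabulate (λ i → toℕ (proj₂ (lookup w i)))
  values-toSList w = LP.map-tabulate _ proj₂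

  IsSignedPerm⇒IsSPerm : ∀ {n} (w : SP n) → IsSignedPerm w → IsSPerm n (toSList w)
  IsSignedPerm⇒IsSPerm w pw = LP.length-tabulate _ , AllP.tabulate⁺ (λ i → toℕ<n _) ,
    subst Unique (sym (values-toSList w)) (UP.tabulate⁺ (λ {i} {j} e → pw i j (toℕ-injective e)))

  IsSPerm⇒IsSignedPerm : ∀ {n} (w : SP n) → IsSPerm n (toSList w) → IsSignedPerm w
  IsSPerm⇒IsSignedPerm w (_ , _ , u) i j e = Unique-tabulate⁻ _ (subst Unique (values-toSList w) u) i j (cong toℕ e)

  AllFrom-tabulate⁻ : ∀ {P : ℕ → Signed → Set} {m} b (f : Fin m → Signed) → AllFrom P b (L.tabulate f) → ∀ i → P (b + toℕ i) (f i)
  AllFrom-tabulate⁻ {P} b f (p , _) zero = subst (λ z → P z (f zero)) (sym (+-identityʳ b)) p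
  AllFrom-tabulate⁻ {P} b f (_ , ps) (suc i) = subst (λ z → P z (f (suc i))) (sym (+-suc b (toℕ i))) (AllFrom-tabulate⁻ (suc b) (λ x → f (suc x)) ps i)

  AllFrom-tabulate⁺ : ∀ {P : ℕ → Signed → Set} {m} b (f : Fin m → Signed) → (∀ i → P (b + toℕ i) (f i)) → AllFrom P b (L.tabulate f)
  AllFrom-tabulate⁺ {P} {zero} b f h = tt
  AllFrom-tabulate⁺ {P} {suc m} b f h = subst (λ z → P z (f zero)) (+-identityʳ b) (h zero) ,
    AllFrom-tabulate⁺ (suc b) (λ x → f (suc x)) (λ i → subst (λ z → P z (f (suc i))) (+-suc b (toℕ i)) (h (suc i)))

  xor≡false : ∀ s t → s xor t ≡ false → t ≡ false → s ≡ false
  xor≡false false t _ _ = refl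
  xor≡false true false () refl

  preservesTail⇒cutCompatible : ∀ {n} (g : Fin n) (w : SP n) → PreservesTail g w → ∀ j → CutCompatible (toℕ g) (toℕ j) (entry w j)
  preservesTail⇒cutCompatible g w q j = (λ c≤i → proj₂ (q (false , j)) (refl , c≤i)) , sec
    where
    sec : toℕ j < toℕ g → toℕ (proj₂ (lookup w j)) < toℕ g
    sec i<c with toℕ g ≤? toℕ (proj₂ (lookup w j)) | proj₁ (lookup w j) in eσ
    ... | no ¬p | _ = ≰⇒> ¬p
    ... | yes p | false = ⊥-elim (<⇒≱ i<c (proj₂ (proj₁ (q (false , j)) (eσ , p))))
    ... | yes p | true = ⊥-elim (true≢false (proj₁ (proj₁ (q (true , j)) (cong (true xor_) eσ , p))))
      where
      true≢false : true ≢ false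
      true≢false ()

  cutCompatible⇒preservesTail : ∀ {n} (g : Fin n) (w : SP n) → (∀ j → CutCompatible (toℕ g) (toℕ j) (entry w j)) → PreservesTail g w
  cutCompatible⇒preservesTail g w ok (s , j) = to , from
    where
    to : InTail g (act w (s , j)) → InTail g (s , j)
    to (e , c≤a) with toℕ g ≤? toℕ j
    ... | yes c≤i = xor≡false s _ e (proj₁ (proj₁ (ok j) c≤i)) , c≤i
    ... | no ¬c≤i = ⊥-elim (<⇒≱ (proj₂ (ok j) (≰⇒> ¬c≤i)) c≤a)
    from : InTail g (s , j) → InTail g (act w (s , j))
    from (refl , c≤i) = proj₁ (ok j) c≤i

  preservesTail⇔cutAt : ∀ {n} (g : Fin n) (w : SP n) → Iff (PreservesTail g w) (CutAt (toℕ g) (toSList w))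
  preservesTail⇔cutAt g w = (λ q → AllFrom-tabulate⁺ 0 _ (preservesTail⇒cutCompatible g w q)) , (λ c → cutCompatible⇒preservesTail g w (AllFrom-tabulate⁻ 0 _ c))

  ∣tabulate∣≡countBelow : ∀ {n} (h : ℕ → Bool) → ∣ V.tabulate {n = n} (λ g → h (toℕ g)) ∣ ≡ countBelow h n
  ∣tabulate∣≡countBelow {zero} h = refl
  ∣tabulate∣≡countBelow {suc n} h with h 0
  ... | true = cong suc (∣tabulate∣≡countBelow {n} (λ x → h (suc x)))
  ... | false = ∣tabulate∣≡countBelow {n} (λ x → h (suc x))

  Bool-ext : ∀ {x y : Bool} → (x ≡ true → y ≡ true) → (y ≡ true → x ≡ true) → x ≡ y
  Bool-ext {true} {true} f g = refl
  Bool-ext {true} {false} f g = sym (f refl)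
  Bool-ext {false} {true} f g = g refl
  Bool-ext {false} {false} f g = refl

  cutSet : ∀ {n} → SP n → Subset n
  cutSet w = V.tabulate (λ g → does (CutAt? (toℕ g) (toSList w)))

  lookup-cutSet : ∀ {n} (w : SP n) g → lookup (cutSet w) g ≡ does (CutAt? (toℕ g) (toSList w))
  lookup-cutSet w g = lookup∘tabulate (λ g → does (CutAt? (toℕ g) (toSList w))) g

  cutSet-spec : ∀ {n} (w : SP n) → IsSignedPerm w → ∀ g → Iff (lookup (cutSet w) g ≡ true) (InC w g)
  cutSet-spec w pw g =
    (λ e → preservesTail⇒InC w g pw (proj₂ (preservesTail⇔cutAt g w) (does≡true⇒ (CutAt? (toℕ g) (toSList w)) (trans (sym (lookup-cutSet w g)) e)))) ,
    (λ ic → trans (lookup-cutSet w g) (dec-true (CutAt? (toℕ g) (toSList w)) (proj₁ (preservesTail⇔cutAt g w) (InC⇒preservesTail w g pw ic))))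

  CSize⇒numCuts : ∀ {n} (w : SP n) k → IsSignedPerm w → CSize w k → numCuts n (toSList w) ≡ k
  CSize⇒numCuts {n} w k pw (S , mem , sz) = trans (sym (∣tabulate∣≡countBelow {n} (λ c → does (CutAt? c (toSList w))))) (trans (cong ∣_∣ (sym S≡cutSet)) sz)
    where
    S≡cutSet : S ≡ cutSet w
    S≡cutSet = trans (sym (tabulate∘lookup S)) (trans (tabulate-cong (λ g →
           Bool-ext (λ e → proj₂ (cutSet-spec w pw g) (Equivalence.to (mem g) (lookup⇒[]= g S e)))
                    (λ e → []=⇒lookup (Equivalence.from (mem g) (proj₁ (cutSet-spec w pw g) e))))) (tabulate∘lookup (cutSet w)))

  numCuts⇒CSize : ∀ {n} (w : SP n) k → IsSignedPerm w → numCuts n (toSList w) ≡ k → CSize w k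
  numCuts⇒CSize {n} w k pw e =
    cutSet w ,
    (λ g → mk⇔ (λ m → proj₁ (cutSet-spec w pw g) ([]=⇒lookup m)) (λ ic → lookup⇒[]= g (cutSet w) (proj₂ (cutSet-spec w pw g) ic))) ,
    trans (∣tabulate∣≡countBelow {n} (λ c → does (CutAt? c (toSList w)))) e

  lookupMaybe : SList → ℕ → Maybe Signed
  lookupMaybe [] _ = nothing
  lookupMaybe (x ∷ xs) zero = just x
  lookupMaybe (x ∷ xs) (suc k) = lookupMaybe xs k

  toFinOr : ∀ n → ℕ → Fin n → Fin n
  toFinOr n a d with a <? n
  ... | yes p = fromℕ< p
  ... | no _ = d

  -- Missing or out-of-range entries become the junk value (false , i); only valid lists are decoded.
  fromSigned : ∀ {n} → Fin n → Maybe Signed → Bool × Fin n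
  fromSigned i nothing = (false , i)
  fromSigned {n} i (just (s , a)) = (s , toFinOr n a i)

  fromSList : ∀ n → SList → SP n
  fromSList n r = tabulate (λ i → fromSigned i (lookupMaybe r (toℕ i)))

  lookupMaybe-tabulate : ∀ {m} (f : Fin m → Signed) (i : Fin m) → lookupMaybe (L.tabulate f) (toℕ i) ≡ just (f i)
  lookupMaybe-tabulate f zero = refl
  lookupMaybe-tabulate f (suc i) = lookupMaybe-tabulate (λ x → f (suc x)) i

  toFinOr-toℕ : ∀ n (a : Fin n) d → toFinOr n (toℕ a) d ≡ a
  toFinOr-toℕ n a d with toℕ a <? n
  ... | yes p = fromℕ<-toℕ a p
  ... | no ¬p = ⊥-elim (¬p (toℕ<n a))

  toℕ-toFinOr : ∀ n a d → a < n → toℕ (toFinOr n a d) ≡ a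
  toℕ-toFinOr n a d a< with a <? n
  ... | yes p = toℕ-fromℕ< p
  ... | no ¬p = ⊥-elim (¬p a<)

  fromSList-toSList : ∀ {n} (w : SP n) → fromSList n (toSList w) ≡ w
  fromSList-toSList {n} w = trans (tabulate-cong h) (tabulate∘lookup w)
    where
    h : ∀ i → fromSigned i (lookupMaybe (toSList w) (toℕ i)) ≡ lookup w i
    h i rewrite lookupMaybe-tabulate (entry w) i = cong (proj₁ (lookup w i) ,_) (toFinOr-toℕ n (proj₂ (lookup w i)) i)

  lookupMaybe-∈ : ∀ (r : SList) k → k < length r → Σ Signed λ x → lookupMaybe r k ≡ just x × x ∈ r
  lookupMaybe-∈ (x ∷ r) zero _ = x , refl , here refl
  lookupMaybe-∈ (x ∷ r) (suc k) (s≤s k<) with lookupMaybe-∈ r k k<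
  ... | (y , e , m) = y , e , there m

  tabulate-lookupMaybe : ∀ (r : SList) n (G : Fin n → Signed) → length r ≡ n → (∀ i → lookupMaybe r (toℕ i) ≡ just (G i)) → L.tabulate G ≡ r
  tabulate-lookupMaybe [] zero G _ _ = refl
  tabulate-lookupMaybe (x ∷ r) (suc n) G l h =
    cong₂ _∷_ (sym (just-injective (h zero))) (tabulate-lookupMaybe r n (λ i → G (suc i)) (NP.suc-injective l) (λ i → h (suc i)))

  toSList-fromSList : ∀ n r → IsSPerm n r → toSList (fromSList n r) ≡ r
  toSList-fromSList n r (len , bnd , _) = tabulate-lookupMaybe r n _ len h
    where
    h : ∀ i → lookupMaybe r (toℕ i) ≡ just (entry (fromSList n r) i)
    h i rewrite lookup∘tabulate (λ i → fromSigned i (lookupMaybe r (toℕ i))) i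
      with lookupMaybe-∈ r (toℕ i) (subst (toℕ i <_) (sym len) (toℕ<n i))
    ... | ((s , a) , e , m) rewrite e = cong (λ z → just (s , z)) (sym (toℕ-toFinOr n a i (All.lookup bnd m)))


  withCutsPerms : ∀ n k → List (SP n)
  withCutsPerms n k = map (fromSList n) (withCuts k n)

  cardB-cutCount : ∀ n k → CardB n k (cutCount n k)
  cardB-cutCount n k = withCutsPerms n k , uniq , length-map (fromSList n) (withCuts k n) , mem
    where
    uniq : Unique (withCutsPerms n k)
    uniq = Unique-map⁺-local (fromSList n) (withCuts k n) (withCuts-unique k n) (λ {x} {y} mx my e →
      trans (sym (toSList-fromSList n x (proj₁ (proj₁ (∈-withCuts k n x) mx))))
        (trans (cong toSList e) (toSList-fromSList n y (proj₁ (proj₁ (∈-withCuts k n y) my)))))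
    mem : ∀ w → (w ∈ withCutsPerms n k) ⇔ (IsSignedPerm w × CSize w k)
    mem w = mk⇔ to from
      where
      to : w ∈ withCutsPerms n k → IsSignedPerm w × CSize w k
      to m with ∈-map⁻ (fromSList n) m
      ... | (r , mr , refl) with proj₁ (∈-withCuts k n r) mr
      ...   | (vr , e) = IsSPerm⇒IsSignedPerm w (subst (IsSPerm n) (sym tr) vr) , numCuts⇒CSize w k pw (trans (cong (numCuts n) tr) e)
        where
        tr : toSList (fromSList n r) ≡ r
        tr = toSList-fromSList n r vr
        pw : IsSignedPerm w
        pw = IsSPerm⇒IsSignedPerm w (subst (IsSPerm n) (sym tr) vr)
      from : IsSignedPerm w × CSize w k → w ∈ withCutsPerms n k
      from (pw , cs) = subst (_∈ withCutsPerms n k) (fromSList-toSList w)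
        (∈-map⁺ (fromSList n) (proj₂ (∈-withCuts k n (toSList w)) (IsSignedPerm⇒IsSPerm w pw , CSize⇒numCuts w k pw cs)))


module Series where

  open import Defs
  open Cuts using (indecCount; cutCount; cutCount-suc; count-signedPerms-by-firstCut; count-perms-by-firstProperCut)
  open import Data.Nat as ℕ using (ℕ; zero; suc; _<_; s≤s; _∸_; _!)
  import Data.Nat.Properties as NP
  open import Data.Nat.ListAction as NL using ()
  open import Data.Integer using (ℤ; +_; _+_; _*_; _-_; -_; 0ℤ; 1ℤ)
  import Data.Integer.Properties as ZP
  open import Data.Integer.Tactic.RingSolver using (solve-∀)
  open import Algebra.Properties.AbelianGroup ZP.+-0-abelianGroup using (∙-cancelˡ; ∙-cancelʳ)
  open import Data.List using (List; []; _∷_; map; upTo; _++_; applyUpTo; [_])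
  open import Data.List.Properties using (upTo-∷ʳ; map-++)
  open import Data.List.Relation.Unary.All as All using (All; []; _∷_)
  import Data.List.Relation.Unary.All.Properties as AllP
  open import Data.List.Membership.Propositional.Properties using (∈-upTo⁻)
  open import Data.Sum using (inj₁; inj₂)
  open import Relation.Binary.PropositionalEquality hiding ([_])

  sumℤ-++ : ∀ xs ys → sumℤ (xs ++ ys) ≡ sumℤ xs + sumℤ ys
  sumℤ-++ [] ys = sym (ZP.+-identityˡ (sumℤ ys))
  sumℤ-++ (x ∷ xs) ys = trans (cong (λ z → x + z) (sumℤ-++ xs ys)) (sym (ZP.+-assoc x (sumℤ xs) (sumℤ ys)))

  sumℤ-cong : ∀ {A : Set} (f g : A → ℤ) (l : List A) → All (λ x → f x ≡ g x) l → sumℤ (map f l) ≡ sumℤ (map g l)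
  sumℤ-cong f g [] [] = refl
  sumℤ-cong f g (x ∷ l) (p ∷ ps) = cong₂ _+_ p (sumℤ-cong f g l ps)

  sumℤ-zero : ∀ {A : Set} (f : A → ℤ) (l : List A) → All (λ x → f x ≡ 0ℤ) l → sumℤ (map f l) ≡ 0ℤ
  sumℤ-zero f [] [] = refl
  sumℤ-zero f (x ∷ l) (p ∷ ps) = cong₂ _+_ p (sumℤ-zero f l ps)

  sumℤ-+ : ∀ {A : Set} (f g : A → ℤ) (l : List A) → sumℤ (map (λ x → f x + g x) l) ≡ sumℤ (map f l) + sumℤ (map g l)
  sumℤ-+ f g [] = refl
  sumℤ-+ f g (x ∷ l) = trans (cong (λ z → f x + g x + z) (sumℤ-+ f g l)) (interchange (f x) (g x) (sumℤ (map f l)) (sumℤ (map g l)))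
    where
    interchange : ∀ a b c d → a + b + (c + d) ≡ a + c + (b + d)
    interchange = solve-∀

  sumℤ-neg : ∀ {A : Set} (f : A → ℤ) (l : List A) → sumℤ (map (λ x → - f x) l) ≡ - sumℤ (map f l)
  sumℤ-neg f [] = refl
  sumℤ-neg f (x ∷ l) = trans (cong (λ z → - f x + z) (sumℤ-neg f l)) (sym (ZP.neg-distrib-+ (f x) (sumℤ (map f l))))

  sumℤ-*-distribʳ-- : ∀ {A : Set} (f g h : A → ℤ) (l : List A) →
    sumℤ (map (λ x → (f x - g x) * h x) l) ≡ sumℤ (map (λ x → f x * h x) l) - sumℤ (map (λ x → g x * h x) l)
  sumℤ-*-distribʳ-- f g h [] = refl
  sumℤ-*-distribʳ-- f g h (x ∷ l) = trans (cong (λ z → (f x - g x) * h x + z) (sumℤ-*-distribʳ-- f g h l)) (rearrange (f x) (g x) (h x) _ _)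
    where
    rearrange : ∀ a b c s t → (a - b) * c + (s - t) ≡ a * c + s - (b * c + t)
    rearrange = solve-∀

  sumℤ-pos : ∀ {A : Set} (h : A → ℕ) (l : List A) → sumℤ (map (λ x → + h x) l) ≡ + NL.sum (map h l)
  sumℤ-pos h [] = refl
  sumℤ-pos h (x ∷ l) = trans (cong (λ z → + h x + z) (sumℤ-pos h l)) (sym (ZP.pos-+ (h x) (NL.sum (map h l))))

  sumℤ-pos-* : ∀ (f g : ℕ → ℕ) (l : List ℕ) → sumℤ (map (λ x → + f x * + g x) l) ≡ + NL.sum (map (λ x → f x ℕ.* g x) l)
  sumℤ-pos-* f g l = trans (sumℤ-cong _ _ l (All.universal (λ x → sym (ZP.pos-* (f x) (g x))) l)) (sumℤ-pos (λ x → f x ℕ.* g x) l)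

  All-<-upTo : ∀ n → All (_< n) (upTo n)
  All-<-upTo n = All.tabulate ∈-upTo⁻

  sumℤ-upTo-suc : ∀ (f : ℕ → ℤ) n → sumℤ (map f (upTo (suc n))) ≡ sumℤ (map f (upTo n)) + f n
  sumℤ-upTo-suc f n = begin
      sumℤ (map f (upTo (suc n)))      ≡⟨ cong (λ z → sumℤ (map f z)) (sym (upTo-∷ʳ n)) ⟩
      sumℤ (map f (upTo n ++ [ n ]))   ≡⟨ cong sumℤ (map-++ f (upTo n) [ n ]) ⟩
      sumℤ (map f (upTo n) ++ [ f n ]) ≡⟨ sumℤ-++ (map f (upTo n)) [ f n ] ⟩
      sumℤ (map f (upTo n)) + (f n + 0ℤ) ≡⟨ cong (λ z → sumℤ (map f (upTo n)) + z) (ZP.+-identityʳ (f n)) ⟩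
      sumℤ (map f (upTo n)) + f n ∎
    where open ≡-Reasoning

  oneS-⋆ : ∀ (X : PS) n → (oneS ⋆ X) n ≡ X n
  oneS-⋆ X n = begin
      1ℤ * X n + sumℤ (map (λ i → oneS i * X (n ∸ i)) (applyUpTo suc n))
    ≡⟨ cong (λ z → 1ℤ * X n + z) (sumℤ-zero _ _ (AllP.applyUpTo⁺₂ suc n (λ _ → refl))) ⟩
      1ℤ * X n + 0ℤ
    ≡⟨ trans (ZP.+-identityʳ _) (ZP.*-identityˡ (X n)) ⟩
      X n ∎
    where open ≡-Reasoning

  oneS-∸ : ∀ {i n} → i < n → oneS (n ∸ i) ≡ 0ℤ
  oneS-∸ {zero} {suc n} _ = refl
  oneS-∸ {suc i} {suc n} (s≤s i<n) = oneS-∸ i<n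

  sumℤ-*-oneS : ∀ (Z : ℕ → ℤ) n → sumℤ (map (λ i → Z i * oneS (n ∸ i)) (upTo (suc n))) ≡ Z n
  sumℤ-*-oneS Z n = begin
      sumℤ (map (λ i → Z i * oneS (n ∸ i)) (upTo (suc n)))
    ≡⟨ sumℤ-upTo-suc _ n ⟩
      sumℤ (map (λ i → Z i * oneS (n ∸ i)) (upTo n)) + Z n * oneS (n ∸ n)
    ≡⟨ cong₂ _+_ (sumℤ-zero _ (upTo n) (All.map (λ {i} i<n → trans (cong (Z i *_) (oneS-∸ i<n)) (ZP.*-zeroʳ (Z i))) (All-<-upTo n)))
                 (trans (cong (λ z → Z n * oneS z) (NP.n∸n≡0 n)) (ZP.*-identityʳ (Z n))) ⟩
      0ℤ + Z n
    ≡⟨ ZP.+-identityˡ (Z n) ⟩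
      Z n ∎
    where open ≡-Reasoning

  -- Solving X ⋆ factS = … coefficient by coefficient: factS 0 = 1, so the top term of
  -- (X ⋆ factS) n is X n and the rest only involves X i for i < n.
  ⋆factS-injective : ∀ (X Y : PS) → (∀ n → (X ⋆ factS) n ≡ (Y ⋆ factS) n) → ∀ n → X n ≡ Y n
  ⋆factS-injective X Y h n = go (suc n) n (NP.n<1+n n)
    where
    lower : PS → ℕ → ℤ
    lower Z n = sumℤ (map (λ i → Z i * factS (n ∸ i)) (upTo n))
    ⋆factS-top : ∀ (Z : PS) n → (Z ⋆ factS) n ≡ lower Z n + Z n
    ⋆factS-top Z n = trans (sumℤ-upTo-suc (λ i → Z i * factS (n ∸ i)) n)
      (cong (λ z → lower Z n + z) (trans (cong (λ z → Z n * + (z !)) (NP.n∸n≡0 n)) (ZP.*-identityʳ (Z n))))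
    go : ∀ m i → i < m → X i ≡ Y i
    go (suc m) i i< with NP.m≤n⇒m<n∨m≡n (NP.≤-pred i<)
    ... | inj₁ i<m = go m i i<m
    ... | inj₂ refl = ∙-cancelˡ (lower Y i) (X i) (Y i) (begin
        lower Y i + X i ≡⟨ cong (_+ X i) (sumℤ-cong _ _ (upTo i) (All.map (λ {j} j<i → cong (_* factS (i ∸ j)) (sym (go i j j<i))) (All-<-upTo i))) ⟩
        lower X i + X i ≡⟨ sym (⋆factS-top X i) ⟩
        (X ⋆ factS) i   ≡⟨ h i ⟩
        (Y ⋆ factS) i   ≡⟨ ⋆factS-top Y i ⟩
        lower Y i + Y i ∎)
      where open ≡-Reasoning

  module _ (f : PS) where

    oneMinusT-∸ : ∀ m {j k} → j < k → oneMinusT f m (suc k ∸ j) ≡ 0ℤ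
    oneMinusT-∸ m {zero} {suc k} _ = refl
    oneMinusT-∸ m {suc j} {suc k} (s≤s j<k) = oneMinusT-∸ m j<k

    sumℤ-*-oneMinusT : ∀ (a : ℕ → ℤ) m k →
      sumℤ (map (λ j → a j * oneMinusT f m (suc k ∸ j)) (upTo (suc (suc k)))) ≡ a k * (- f m) + a (suc k) * oneS m
    sumℤ-*-oneMinusT a m k = trans (sumℤ-upTo-suc h (suc k))
      (cong₂ _+_ (trans (sumℤ-upTo-suc h k) (trans (cong (_+ h k) below) (trans (ZP.+-identityˡ (h k)) at-k))) at-suc-k)
      where
      h : ℕ → ℤ
      h j = a j * oneMinusT f m (suc k ∸ j)
      below : sumℤ (map h (upTo k)) ≡ 0ℤ
      below = sumℤ-zero h (upTo k) (All.map (λ {j} j<k → trans (cong (a j *_) (oneMinusT-∸ m j<k)) (ZP.*-zeroʳ (a j))) (All-<-upTo k))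
      at-k : h k ≡ a k * (- f m)
      at-k rewrite NP.m+n∸n≡m 1 k = refl
      at-suc-k : h (suc k) ≡ a (suc k) * oneS m
      at-suc-k rewrite NP.n∸n≡0 k = refl

    ⋆₂oneMinusT-zero : ∀ (X : PS2) n → (X ⋆₂ oneMinusT f) n 0 ≡ X n 0
    ⋆₂oneMinusT-zero X n = trans (sumℤ-cong _ (λ i → X i 0 * oneS (n ∸ i)) (upTo (suc n)) (All.universal (λ i → ZP.+-identityʳ _) _))
      (sumℤ-*-oneS (λ i → X i 0) n)

    ⋆₂oneMinusT-suc : ∀ (X : PS2) n k →
      (X ⋆₂ oneMinusT f) n (suc k) ≡ X n (suc k) + sumℤ (map (λ i → X i k * (- f (n ∸ i))) (upTo (suc n)))
    ⋆₂oneMinusT-suc X n k = begin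
        (X ⋆₂ oneMinusT f) n (suc k)
      ≡⟨ sumℤ-cong _ (λ i → X i k * (- f (n ∸ i)) + X i (suc k) * oneS (n ∸ i)) (upTo (suc n))
           (All.universal (λ i → sumℤ-*-oneMinusT (X i) (n ∸ i) k) _) ⟩
        sumℤ (map (λ i → X i k * (- f (n ∸ i)) + X i (suc k) * oneS (n ∸ i)) (upTo (suc n)))
      ≡⟨ sumℤ-+ (λ i → X i k * (- f (n ∸ i))) (λ i → X i (suc k) * oneS (n ∸ i)) (upTo (suc n)) ⟩
        S + sumℤ (map (λ i → X i (suc k) * oneS (n ∸ i)) (upTo (suc n)))
      ≡⟨ cong (λ z → S + z) (sumℤ-*-oneS (λ i → X i (suc k)) n) ⟩
        S + X n (suc k)
      ≡⟨ ZP.+-comm S (X n (suc k)) ⟩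
        X n (suc k) + S ∎
      where
      open ≡-Reasoning
      S : ℤ
      S = sumℤ (map (λ i → X i k * (- f (n ∸ i))) (upTo (suc n)))

    -- Induction on the power of t: the t^(k+1) coefficient of X · (1 - t f) is X_{k+1} plus a
    -- term depending only on X_k.
    ⋆₂oneMinusT-injective : ∀ (X Y : PS2) → (∀ n k → (X ⋆₂ oneMinusT f) n k ≡ (Y ⋆₂ oneMinusT f) n k) → ∀ k n → X n k ≡ Y n k
    ⋆₂oneMinusT-injective X Y h zero n = trans (sym (⋆₂oneMinusT-zero X n)) (trans (h n 0) (⋆₂oneMinusT-zero Y n))
    ⋆₂oneMinusT-injective X Y h (suc k) n = ∙-cancelʳ SX (X n (suc k)) (Y n (suc k)) (begin
        X n (suc k) + SX             ≡⟨ sym (⋆₂oneMinusT-suc X n k) ⟩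
        (X ⋆₂ oneMinusT f) n (suc k) ≡⟨ h n (suc k) ⟩
        (Y ⋆₂ oneMinusT f) n (suc k) ≡⟨ ⋆₂oneMinusT-suc Y n k ⟩
        Y n (suc k) + SY             ≡⟨ cong (λ z → Y n (suc k) + z) (sym SX≡SY) ⟩
        Y n (suc k) + SX ∎)
      where
      open ≡-Reasoning
      SX SY : ℤ
      SX = sumℤ (map (λ i → X i k * (- f (n ∸ i))) (upTo (suc n)))
      SY = sumℤ (map (λ i → Y i k * (- f (n ∸ i))) (upTo (suc n)))
      SX≡SY : SX ≡ SY
      SX≡SY = sumℤ-cong _ _ (upTo (suc n)) (All.universal (λ i → cong (_* (- f (n ∸ i))) (⋆₂oneMinusT-injective X Y h k i)) _)

  fB-coefficients : (fB : PS) → (∀ n → (fB ⋆ factS) n ≡ twoFactS n) → ∀ n → fB n ≡ + cutCount n 0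
  fB-coefficients fB hfB = ⋆factS-injective fB (λ i → + cutCount i 0) (λ n → trans (hfB n) (sym (cutFree⋆factS n)))
    where
    cutFree⋆factS : ∀ n → ((λ i → + cutCount i 0) ⋆ factS) n ≡ twoFactS n
    cutFree⋆factS n = trans (sumℤ-pos-* (λ i → cutCount i 0) (λ i → (n ∸ i) !) (upTo (suc n)))
      (cong +_ (sym (count-signedPerms-by-firstCut n)))

  oneMinusIndec : PS
  oneMinusIndec n = oneS n - + indecCount n

  oneMinusIndec-⋆factS : ∀ n → (oneMinusIndec ⋆ factS) n ≡ oneS n
  oneMinusIndec-⋆factS n = begin
      (oneMinusIndec ⋆ factS) n
    ≡⟨ sumℤ-*-distribʳ-- oneS (λ i → + indecCount i) (λ i → factS (n ∸ i)) (upTo (suc n)) ⟩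
      (oneS ⋆ factS) n - sumℤ (map (λ i → + indecCount i * + ((n ∸ i) !)) (upTo (suc n)))
    ≡⟨ cong₂ _-_ (oneS-⋆ factS n) (sumℤ-pos-* indecCount (λ i → (n ∸ i) !) (upTo (suc n))) ⟩
      factS n - + NL.sum (map (λ i → indecCount i ℕ.* (n ∸ i) !) (upTo (suc n)))
    ≡⟨ byFirstProperCut n ⟩
      oneS n ∎
    where
    open ≡-Reasoning
    byFirstProperCut : ∀ n → factS n - + NL.sum (map (λ i → indecCount i ℕ.* (n ∸ i) !) (upTo (suc n))) ≡ oneS n
    byFirstProperCut zero = refl
    byFirstProperCut (suc n) = trans (cong (λ z → factS (suc n) - + z) (sym (count-perms-by-firstProperCut n)))
      (ZP.+-inverseʳ (+ (suc n !)))

  fA-coefficients : (inv fA : PS) → (∀ n → (inv ⋆ factS) n ≡ oneS n) → (∀ n → fA n ≡ oneS n - inv n) →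
    ∀ n → fA n ≡ + indecCount n
  fA-coefficients inv fA hinv hfA n = begin
      fA n                                 ≡⟨ hfA n ⟩
      oneS n - inv n                       ≡⟨ cong (λ z → oneS n - z) (inv≡ n) ⟩
      oneS n - (oneS n - + indecCount n)   ≡⟨ a-[a-b]≡b (oneS n) (+ indecCount n) ⟩
      + indecCount n ∎
    where
    open ≡-Reasoning
    inv≡ : ∀ n → inv n ≡ oneMinusIndec n
    inv≡ = ⋆factS-injective inv oneMinusIndec (λ n → trans (hinv n) (sym (oneMinusIndec-⋆factS n)))
    a-[a-b]≡b : ∀ a b → a - (a - b) ≡ b
    a-[a-b]≡b = solve-∀

  cutCountSeries : PS2
  cutCountSeries n k = + cutCount n k

  cutCountSeries-⋆₂oneMinusT : (fA fB : PS) → (∀ n → fA n ≡ + indecCount n) → (∀ n → fB n ≡ + cutCount n 0) →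
    ∀ n k → (cutCountSeries ⋆₂ oneMinusT fA) n k ≡ liftS fB n k
  cutCountSeries-⋆₂oneMinusT fA fB fA≡ fB≡ n zero = trans (⋆₂oneMinusT-zero fA cutCountSeries n) (sym (fB≡ n))
  cutCountSeries-⋆₂oneMinusT fA fB fA≡ fB≡ n (suc k) =
    trans (⋆₂oneMinusT-suc fA cutCountSeries n k)
      (trans (cong (λ z → + cutCount n (suc k) + z) lastCut) (ZP.+-inverseʳ (+ cutCount n (suc k))))
    where
    lastCut : sumℤ (map (λ i → + cutCount i k * (- fA (n ∸ i))) (upTo (suc n))) ≡ - (+ cutCount n (suc k))
    lastCut = begin
        sumℤ (map (λ i → + cutCount i k * (- fA (n ∸ i))) (upTo (suc n)))
      ≡⟨ sumℤ-cong _ (λ i → - (+ cutCount i k * + indecCount (n ∸ i))) (upTo (suc n))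
           (All.universal (λ i → trans (cong (λ z → + cutCount i k * (- z)) (fA≡ (n ∸ i)))
                                       (sym (ZP.neg-distribʳ-* (+ cutCount i k) (+ indecCount (n ∸ i))))) _) ⟩
        sumℤ (map (λ i → - (+ cutCount i k * + indecCount (n ∸ i))) (upTo (suc n)))
      ≡⟨ sumℤ-neg (λ i → + cutCount i k * + indecCount (n ∸ i)) (upTo (suc n)) ⟩
        - sumℤ (map (λ i → + cutCount i k * + indecCount (n ∸ i)) (upTo (suc n)))
      ≡⟨ cong -_ (trans (sumℤ-pos-* (λ i → cutCount i k) (λ i → indecCount (n ∸ i)) (upTo (suc n)))
                        (cong +_ (sym (cutCount-suc n k)))) ⟩
        - (+ cutCount n (suc k)) ∎
      where open ≡-Reasoning


open import Defs
open import Data.Nat using (ℕ)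
open import Data.Integer using (+_; _-_)
open import Data.Product using (Σ; _×_; _,_)
open import Relation.Binary.PropositionalEquality using (_≡_; trans; sym)
open Cuts using (cutCount; indecCount)
open Coxeter using (cardB-cutCount)
open Series using (fA-coefficients; fB-coefficients; cutCountSeries; cutCountSeries-⋆₂oneMinusT; ⋆₂oneMinusT-injective)

mainTheorem17 : (inv fA fB : PS)
    → (∀ n → (inv ⋆ factS) n ≡ oneS n)
    → (∀ n → fA n ≡ oneS n - inv n)
    → (∀ n → (fB ⋆ factS) n ≡ twoFactS n)
    → (∀ n → Σ ℕ λ c → fB n ≡ + c × CardB n 0 c)
    × ((Q : PS2) → (∀ n k → (Q ⋆₂ oneMinusT fA) n k ≡ liftS fB n k)
    → ∀ n k → Σ ℕ λ c → Q n k ≡ + c × CardB n k c)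
mainTheorem17 inv fA fB hinv hfA hfB =
    (λ n → cutCount n 0 , fB≡ n , cardB-cutCount n 0) ,
    (λ Q hQ n k → cutCount n k , Q≡cutCountSeries Q hQ k n , cardB-cutCount n k)
  where
  fA≡ : ∀ n → fA n ≡ + indecCount n
  fA≡ = fA-coefficients inv fA hinv hfA
  fB≡ : ∀ n → fB n ≡ + cutCount n 0
  fB≡ = fB-coefficients fB hfB
  Q≡cutCountSeries : (Q : PS2) → (∀ n k → (Q ⋆₂ oneMinusT fA) n k ≡ liftS fB n k) → ∀ k n → Q n k ≡ cutCountSeries n k
  Q≡cutCountSeries Q hQ = ⋆₂oneMinusT-injective fA Q cutCountSeries
    (λ n k → trans (hQ n k) (sym (cutCountSeries-⋆₂oneMinusT fA fB fA≡ fB≡ n k)))
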